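{- Let $m\ge1$ and $N\ge0$. The polynomials $\mu_m(C)$, where $C$ ranges over equivalence classes of binary self-orthogonal linear codes of length $N$ containing the all-ones vector $\mathbf 1$ and of dimension at most $m+1$, form a basis of the space of homogeneous polynomials of degree $N$ in $\mathbb{R}[x_v:v\in\mathbb{F}_2^{\,m}]$ that are invariant under the parabolic subgroup $P$.
   Context: Index the standard basis of $\mathbb{R}^{2^m}$ by $v\in\mathbb{F}_2^{\,m}$; $g\in GL(2^m,\mathbb{R})$ acts on $\mathbb{R}[x_v:v\in\mathbb{F}_2^{\,m}]$ by $(g\cdot p)(x)=p(g^{ -1}x)$. The parabolic subgroup $P$ is generated by the diagonal matrices $\mathrm{diag}((-1)^{q(v)+a})_v$ ($q$ any quadratic form $\sum_{i\le j}c_{ij}v_iv_j$ on $\mathbb{F}_2^{\,m}$, $a\in\{0,1\}$) and the permutation matrices $b_v\mapsto b_{g(v)}$, $g\in AGL(m,2)$. For $M\in\mathbb{F}_2^{m\times N}$ let $\mu_M=\prod_{j=1}^Nx_{M^{(j)}}$, $M^{(j)}$ the $j$-th column. For a code $C\subseteq\mathbb{F}_2^N$, $\mu_m(C)=\sum\mu_M$ over all $M\in\mathbb{F}_2^{m\times N}$ whose rows together with $\mathbf 1$ span $C$. Self-orthogonal means $C\subseteq C^\perp$; codes are equivalent if they differ by a coordinate permutation. -}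

module Defs where

open import Level using (Level; _⊔_)
open import Data.Bool using (Bool; true; false; _∧_; _xor_; if_then_else_; not)
import Data.Bool.Properties as BoolP
open import Data.Nat using (ℕ; zero; suc; _≤_; _≡ᵇ_; _≤ᵇ_)
open import Data.Fin using (Fin; toℕ)
open import Data.Fin.Permutation using (Permutation′; _⟨$⟩ʳ_)
open import Data.List using (List; []; _∷_; _++_; map; foldr)
open import Data.List using () renaming (allFin to allFinL)
open import Data.Vec using (Vec; []; _∷_; replicate; zipWith; lookup; tabulate)
  renaming (map to mapV)
import Data.Vec.Properties as VecP
open import Data.Product using (Σ; ∃; _×_; _,_)
open import Relation.Nullary using (¬_)
open import Relation.Nullary.Decidable using (⌊_⌋)
open import Relation.Binary.PropositionalEquality using (_≡_)
open import Algebra.Bundles using (CommutativeRing)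

-- F₂ = Bool (xor = addition, ∧ = multiplication); F₂^n = Vec Bool n

allVecsOf : {A : Set} → List A → (n : ℕ) → List (Vec A n)
allVecsOf xs zero = [] ∷ []
allVecsOf xs (suc n) = foldr (λ a acc → map (a ∷_) (allVecsOf xs n) ++ acc) [] xs

allVecs : (n : ℕ) → List (Vec Bool n)
allVecs = allVecsOf (false ∷ true ∷ [])

eqV : {n : ℕ} → Vec Bool n → Vec Bool n → Bool
eqV x y = ⌊ VecP.≡-dec BoolP._≟_ x y ⌋

zeroV : {n : ℕ} → Vec Bool n
zeroV = replicate _ false

onesV : {n : ℕ} → Vec Bool n
onesV = replicate _ true

addV : {n : ℕ} → Vec Bool n → Vec Bool n → Vec Bool n
addV = zipWith _xor_

dot : {n : ℕ} → Vec Bool n → Vec Bool n → Bool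
dot x y = Data.Vec.foldr _ _xor_ false (zipWith _∧_ x y)

lincomb : {k n : ℕ} → Vec Bool k → Vec (Vec Bool n) k → Vec Bool n
lincomb [] [] = zeroV
lincomb (b ∷ λs) (x ∷ xs) = if b then addV x (lincomb λs xs) else lincomb λs xs

countB : {A : Set} → (A → Bool) → List A → ℕ
countB p = foldr (λ a n → if p a then suc n else n) 0

allL : {A : Set} → (A → Bool) → List A → Bool
allL f = foldr (λ a b → f a ∧ b) true

anyL : {A : Set} → (A → Bool) → List A → Bool
anyL f = foldr (λ a b → if f a then true else b) false

xorSum : {A : Set} → (A → Bool) → List A → Bool
xorSum f = foldr (λ a b → f a xor b) false

Code : ℕ → Set
Code N = Vec Bool N → Bool

IsLinearCode : {N : ℕ} → Code N → Set
IsLinearCode C = (C zeroV ≡ true)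
  × (∀ x y → C x ≡ true → C y ≡ true → C (addV x y) ≡ true)

SelfOrthogonal : {N : ℕ} → Code N → Set
SelfOrthogonal C = ∀ x y → C x ≡ true → C y ≡ true → dot x y ≡ false

ContainsOne : {N : ℕ} → Code N → Set
ContainsOne C = C onesV ≡ true

HasDim : {N : ℕ} → Code N → ℕ → Set
HasDim {N} C k = Σ (Vec (Vec Bool N) k) λ B →
    (∀ (λs : Vec Bool k) → lincomb λs B ≡ zeroV → λs ≡ replicate k false)
  × (∀ x → (C x ≡ true → ∃ λ (λs : Vec Bool k) → lincomb λs B ≡ x)
         × ((∃ λ (λs : Vec Bool k) → lincomb λs B ≡ x) → C x ≡ true))

Admissible : (m : ℕ) {N : ℕ} → Code N → Set
Admissible m C = IsLinearCode C × SelfOrthogonal C × ContainsOne C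
  × (∃ λ k → k ≤ suc m × HasDim C k)

permV : {N : ℕ} → Permutation′ N → Vec Bool N → Vec Bool N
permV σ x = tabulate (λ i → lookup x (σ ⟨$⟩ʳ i))

Equivalent : {N : ℕ} → Code N → Code N → Set
Equivalent {N} C C' = Σ (Permutation′ N) λ σ → ∀ x → C x ≡ C' (permV σ x)

-- Coefficient field: a field of characteristic 0 (ℝ is one)

module _ {c ℓ : Level} (R : CommutativeRing c ℓ) where
  open CommutativeRing R
  ringℕ : ℕ → Carrier
  ringℕ zero = 0#
  ringℕ (suc n) = 1# + ringℕ n

record CharZeroField (c ℓ : Level) : Set (Level.suc (c ⊔ ℓ)) where
  field
    cring : CommutativeRing c ℓ
  open CommutativeRing cring public
  field
    nontrivial : ¬ (1# ≈ 0#)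
    inverse : ∀ x → ¬ (x ≈ 0#) → ∃ λ y → x * y ≈ 1#
    charZero : ∀ n → ¬ (ringℕ cring (suc n) ≈ 0#)

-- Polynomials in variables x_v (v ∈ F₂^m), via coefficient functions on
-- exponent vectors e : F₂^m → ℕ  (monomial ∏_v x_v^{e v}).

Exp : ℕ → Set
Exp m = Vec Bool m → ℕ

deg : {m : ℕ} → Exp m → ℕ
deg {m} e = foldr (λ v n → e v Data.Nat.+ n) 0 (allVecs m)

-- Elements of P (group generated by the generators; every generator has
-- its inverse among the generators, so the generated monoid is the group)
applyM : {m : ℕ} → (Fin m → Fin m → Bool) → Vec Bool m → Vec Bool m
applyM {m} A v = tabulate (λ i → xorSum (λ j → A i j ∧ lookup v j) (allFinL m))

IsInvertible : {m : ℕ} → (Fin m → Fin m → Bool) → Set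
IsInvertible {m} A = ∃ λ (B : Fin m → Fin m → Bool) →
  (∀ v → applyM B (applyM A v) ≡ v) × (∀ v → applyM A (applyM B v) ≡ v)

quadForm : {m : ℕ} → (Fin m → Fin m → Bool) → Vec Bool m → Bool
quadForm {m} c v = xorSum (λ i → xorSum (λ j →
   (toℕ i ≤ᵇ toℕ j) ∧ c i j ∧ lookup v i ∧ lookup v j) (allFinL m)) (allFinL m)

data PElem (m : ℕ) : Set where
  idP   : PElem m
  -- diag((-1)^{q(v)+a})_v
  diagP : (c : Fin m → Fin m → Bool) (a : Bool) → PElem m
  -- permutation matrix b_v ↦ b_{g v}, g v = A v + b
  affP  : (A : Fin m → Fin m → Bool) (b : Vec Bool m) → IsInvertible A → PElem m
  _∘P_  : PElem m → PElem m → PElem m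

oddℕ : ℕ → Bool
oddℕ zero = false
oddℕ (suc n) = not (oddℕ n)

module Poly {c ℓ : Level} (K : CharZeroField c ℓ) (m : ℕ) where
  open CharZeroField K

  Pol : Set c
  Pol = Exp m → Carrier

  Extensional : Pol → Set ℓ
  Extensional p = ∀ e e' → (∀ v → e v ≡ e' v) → p e ≈ p e'

  HomogeneousOfDeg : ℕ → Pol → Set ℓ
  HomogeneousOfDeg N p = Extensional p × (∀ e → ¬ (deg e ≡ N) → p e ≈ 0#)

  -- (g·p)(x) = p(g⁻¹x), computed on coefficients
  act : PElem m → Pol → Pol
  act idP p = p
  act (diagP q a) p e =
    if xorSum (λ v → oddℕ (e v) ∧ (quadForm q v xor a)) (allVecs m)
    then - p e else p e
  act (affP A b _) p e = p (λ v → e (addV (applyM A v) b))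
  act (g ∘P h) p = act g (act h p)

  Invariant : Pol → Set ℓ
  Invariant p = ∀ g e → act g p e ≈ p e

  InSpace : ℕ → Pol → Set ℓ
  InSpace N p = HomogeneousOfDeg N p × Invariant p

  -- μ_m(C) = Σ { μ_M : M ∈ F₂^{m×N}, rows of M together with 1 span C }
  column : {N : ℕ} → Vec (Vec Bool N) m → Fin N → Vec Bool m
  column M j = mapV (λ row → lookup row j) M

  spansWithOne : {N : ℕ} → Vec (Vec Bool N) m → Code N → Bool
  spansWithOne {N} M C = allL (λ x → ⌊ BoolP._≟_ (C x)
      (anyL (λ λs → eqV (lincomb λs (onesV ∷ M)) x) (allVecs (suc m))) ⌋) (allVecs N)

  hasExp : {N : ℕ} → Vec (Vec Bool N) m → Exp m → Bool
  hasExp {N} M e = allL (λ v → e v ≡ᵇ countB (λ j → eqV (column M j) v) (allFinL N)) (allVecs m)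

  μ : {N : ℕ} → Code N → Pol
  μ {N} C e = ringℕ cring (countB (λ M → spansWithOne M C ∧ hasExp M e)
                                   (allVecsOf (allVecs N) m))

  lincombP : {k : ℕ} → (Fin k → Carrier) → (Fin k → Pol) → Pol
  lincombP {k} λs b e = foldr (λ i s → λs i * b i e + s) 0# (allFinL k)

  IsBasisOfInvariants : (N : ℕ) {k : ℕ} → (Fin k → Pol) → Set (c ⊔ ℓ)
  IsBasisOfInvariants N {k} b =
      (∀ i → InSpace N (b i))
    × (∀ (λs : Fin k → Carrier) → (∀ e → lincombP λs b e ≈ 0#) → ∀ i → λs i ≈ 0#)
    × (∀ p → InSpace N p → ∃ λ (λs : Fin k → Carrier) → ∀ e → p e ≈ lincombP λs b e)

-- μ_m(C) counts the matrices M whose rows together with 1 span C, graded by the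
-- multiset of columns of M (the exponent of the monomial μ_M).  Affine maps of
-- F₂^m act on the columns without changing that span, and a sign generator
-- diag((-1)^{q(v)+a}) multiplies μ_M by (-1)^{Σ_j q(M^(j)) + a N}, a sum of
-- inner products of the generators, so μ_m(C) is P-invariant when C is
-- self-orthogonal.  Conversely the same signs force every invariant to vanish
-- on monomials whose generators are not pairwise orthogonal.  Two matrices
-- spanning the same code are connected by row operations, which are column-wise
-- affine maps, so an invariant is constant on the monomials of one code, while
-- matrices with the same columns up to order span equivalent codes.  Evaluating
-- at one monomial per class therefore gives independence, and the values of an
-- invariant at these monomials give its coordinates.

module Submission where

open import Defs
open import Level using (Level)
open import Algebra.Bundles using (CommutativeRing)
import Algebra.Properties.Ring as RingProps
open import Data.Product using (Σ; ∃; _×_; _,_; proj₁; proj₂)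
open import Relation.Nullary using (¬_; Dec; yes; no)

-- Declared before the remaining imports, whose names (_+_ on ℕ, sym and trans
-- on ≡, ≡-Reasoning) would clash with those of the field.
module CharZeroFieldProperties {c ℓ : Level} (K : CharZeroField c ℓ) where
  open CharZeroField K
  open import Relation.Binary.Reasoning.Setoid setoid

  x*r≈0⇒x≈0 : ∀ {x r} → ¬ (r ≈ 0#) → x * r ≈ 0# → x ≈ 0#
  x*r≈0⇒x≈0 {x} {r} r≉0 xr≈0 = let (y , ry≈1) = inverse r r≉0 in begin
    x           ≈⟨ sym (*-identityʳ x) ⟩
    x * 1#      ≈⟨ *-congˡ (sym ry≈1) ⟩
    x * (r * y) ≈⟨ sym (*-assoc x r y) ⟩
    (x * r) * y ≈⟨ *-congʳ xr≈0 ⟩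
    0# * y      ≈⟨ zeroˡ y ⟩
    0#          ∎

  -x≈x⇒x≈0 : ∀ {x} → - x ≈ x → x ≈ 0#
  -x≈x⇒x≈0 {x} -x≈x = x*r≈0⇒x≈0 (charZero 1) (begin
    x * (1# + (1# + 0#))   ≈⟨ *-congˡ (+-congˡ (+-identityʳ 1#)) ⟩
    x * (1# + 1#)          ≈⟨ distribˡ x 1# 1# ⟩
    x * 1# + x * 1#        ≈⟨ +-cong (*-identityʳ x) (*-identityʳ x) ⟩
    x + x                  ≈⟨ +-congʳ (sym -x≈x) ⟩
    - x + x                ≈⟨ -‿inverseˡ x ⟩
    0#                     ∎)

  *-inverse-cancelʳ : ∀ x {y r} → r * y ≈ 1# → (x * y) * r ≈ x
  *-inverse-cancelʳ x {y} {r} ry≈1 = begin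
    (x * y) * r ≈⟨ *-assoc x y r ⟩
    x * (y * r) ≈⟨ *-congˡ (trans (*-comm y r) ry≈1) ⟩
    x * 1#      ≈⟨ *-identityʳ x ⟩
    x           ∎

open import Data.Bool using (Bool; true; false; T; _∧_; _xor_; if_then_else_; not)
import Data.Bool.Properties as BoolP
open import Data.Bool.Properties using (xor-assoc; xor-comm; ∧-comm; ∧-assoc; ∧-distribˡ-xor; ∧-distribʳ-xor; xor-same)
open import Data.Empty using (⊥; ⊥-elim)
open import Data.Fin using (Fin; zero; suc; toℕ; punchIn; punchOut)
import Data.Fin as F
import Data.Fin.Properties as FinP
open import Data.Fin.Permutation using (Permutation′; _⟨$⟩ʳ_; _⟨$⟩ˡ_; inverseˡ; inverseʳ; insert; insert-punchIn; flip)
import Data.Fin.Permutation as Perm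
open import Data.List using (List; []; _∷_; _++_; map; foldr)
open import Data.List using () renaming (allFin to allFinL; tabulate to tabulateL)
import Data.List.Properties as ListP
open import Data.List.Membership.Propositional using (_∈_; _∉_)
open import Data.List.Membership.Propositional.Properties
  using (∈-allFin; ∈-∃++; ∈-map⁺; ∈-map⁻; ∈-++⁺ˡ; ∈-++⁺ʳ; ∈-++⁻)
open import Data.List.Relation.Unary.Any using (here; there)
open import Data.List.Relation.Unary.All as All using (All; []; _∷_)
open import Data.List.Relation.Unary.AllPairs using ([]; _∷_)
open import Data.List.Relation.Unary.Unique.Propositional using (Unique)
import Data.List.Relation.Unary.Unique.Propositional.Properties as UP
open import Data.List.Relation.Binary.Permutation.Propositional
  using (_↭_; prep; swap; ↭-sym) renaming (refl to ↭refl; trans to ↭trans)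
open import Data.List.Relation.Binary.Permutation.Propositional.Properties using (shift)
open import Data.Nat using (ℕ; zero; suc; _+_; _≤_; _<_; z≤n; s≤s; _<ᵇ_; _≤ᵇ_; _≡ᵇ_)
import Data.Nat.Properties as NatP
open import Algebra.Properties.CommutativeSemigroup NatP.+-commutativeSemigroup
  using () renaming (interchange to +-interchange)
open import Algebra.Properties.CommutativeSemigroup (CommutativeRing.+-commutativeSemigroup BoolP.xor-∧-commutativeRing)
  using () renaming (interchange to xor-interchange)
open import Data.Sum using (_⊎_; inj₁; inj₂; [_,_]′)
open import Data.Vec using (Vec; []; _∷_; lookup; tabulate; replicate) renaming (map to mapV; _++_ to _++ᵛ_)
import Data.Vec as V
import Data.Vec.Properties as VecP
open import Data.Vec.Properties using (lookup∘tabulate; tabulate-cong; lookup-replicate; lookup-zipWith; lookup-map)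
open import Relation.Nullary.Decidable using (⌊_⌋)
open import Relation.Binary.PropositionalEquality
  using (_≡_; _≢_; refl; sym; trans; cong; cong₂; subst; module ≡-Reasoning)
open ≡-Reasoning

-- Enumerations of finite types

IsEnumeration : {A : Set} → List A → Set
IsEnumeration L = Unique L × (∀ x → x ∈ L)

allFin-enumeration : ∀ n → IsEnumeration (allFinL n)
allFin-enumeration n = UP.allFin⁺ n , ∈-allFin

LeftCommutative : {A B : Set} → (A → B → B) → Set
LeftCommutative h = ∀ a b s → h a (h b s) ≡ h b (h a s)

foldr-↭ : {A B : Set} (h : A → B → B) → LeftCommutative h → (z : B) → {xs ys : List A}
  → xs ↭ ys → foldr h z xs ≡ foldr h z ys
foldr-↭ h hc z ↭refl = refl
foldr-↭ h hc z (prep x p) = cong (h x) (foldr-↭ h hc z p)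
foldr-↭ h hc z (swap x y p) = trans (hc x y _) (cong (λ s → h y (h x s)) (foldr-↭ h hc z p))
foldr-↭ h hc z (↭trans p q) = trans (foldr-↭ h hc z p) (foldr-↭ h hc z q)

Unique-tail : {A : Set} {x : A} {xs : List A} → Unique (x ∷ xs) → Unique xs
Unique-tail (_ ∷ u) = u

Unique-dropMiddle : {A : Set} (as : List A) {x : A} {bs : List A} → Unique (as ++ x ∷ bs)
  → Unique (as ++ bs) × x ∉ (as ++ bs)
Unique-dropMiddle [] (px ∷ u) = u , UP.Unique[x∷xs]⇒x∉xs (px ∷ u)
Unique-dropMiddle (a ∷ as) {x} {bs} (pa ∷ u) with Unique-dropMiddle as u
... | u' , nx = (All.tabulate (λ {y} y∈ → All.lookup pa (lift y∈)) ∷ u') , nx'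
  where
  lift : ∀ {y} → y ∈ as ++ bs → y ∈ as ++ x ∷ bs
  lift {y} y∈ with ∈-++⁻ as y∈
  ... | inj₁ p = ∈-++⁺ˡ p
  ... | inj₂ p = ∈-++⁺ʳ as (there p)
  nx' : x ∉ (a ∷ as ++ bs)
  nx' (here refl) = All.lookup pa (∈-++⁺ʳ as (here refl)) refl
  nx' (there p) = nx p

∈-dropMiddle : {A : Set} (as : List A) {x y : A} {bs : List A} → y ∈ as ++ x ∷ bs → y ≢ x → y ∈ as ++ bs
∈-dropMiddle as {x} {y} p ne with ∈-++⁻ as p
... | inj₁ q = ∈-++⁺ˡ q
... | inj₂ (here e) = ⊥-elim (ne e)
... | inj₂ (there q) = ∈-++⁺ʳ as q

unique-sameElements⇒↭ : {A : Set} {xs ys : List A} → Unique xs → Unique ys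
  → (∀ {x} → x ∈ xs → x ∈ ys) → (∀ {x} → x ∈ ys → x ∈ xs) → xs ↭ ys
unique-sameElements⇒↭ {xs = []} {[]} _ _ f g = ↭refl
unique-sameElements⇒↭ {xs = []} {y ∷ ys} _ _ f g with g (here refl)
... | ()
unique-sameElements⇒↭ {xs = x ∷ xs} {ys} ux uy f g with ∈-∃++ (f (here refl))
... | as , bs , refl with Unique-dropMiddle as uy
... | uy' , nx = ↭trans (prep x (unique-sameElements⇒↭ (Unique-tail ux) uy' f' g')) (↭-sym (shift x as bs))
  where
  f' : ∀ {z} → z ∈ xs → z ∈ as ++ bs
  f' {z} p = ∈-dropMiddle as (f (there p)) (λ e → UP.Unique[x∷xs]⇒x∉xs ux (subst (_∈ xs) e p))
  up : ∀ {z} → z ∈ as ++ bs → z ∈ as ++ x ∷ bs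
  up {z} p with ∈-++⁻ as p
  ... | inj₁ q = ∈-++⁺ˡ q
  ... | inj₂ q = ∈-++⁺ʳ as (there q)
  g' : ∀ {z} → z ∈ as ++ bs → z ∈ xs
  g' {z} p with g (up p)
  ... | here e = ⊥-elim (nx (subst (_∈ as ++ bs) e p))
  ... | there q = q

enumerations-↭ : {A : Set} {xs ys : List A} → IsEnumeration xs → IsEnumeration ys → xs ↭ ys
enumerations-↭ (ux , cx) (uy , cy) = unique-sameElements⇒↭ ux uy (λ {x} _ → cy x) (λ {x} _ → cx x)

map-enumeration : {A : Set} {L : List A} (f g : A → A) → (∀ x → f (g x) ≡ x) → (∀ x → g (f x) ≡ x)
  → IsEnumeration L → IsEnumeration (map f L)
map-enumeration f g fg gf (u , c) = UP.map⁺ (λ {x} {y} e → trans (sym (gf x)) (trans (cong g e) (gf y))) u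
  , λ x → subst (_∈ map f _) (fg x) (∈-map⁺ f (c (g x)))

foldr-bijection : {A B : Set} (h : A → B → B) → LeftCommutative h → (z : B) {L : List A} → IsEnumeration L
  → (f g : A → A) → (∀ x → f (g x) ≡ x) → (∀ x → g (f x) ≡ x)
  → foldr (λ a s → h (f a) s) z L ≡ foldr h z L
foldr-bijection h hc z {L} e f g fg gf = trans (sym (ListP.foldr-map h f z L))
  (foldr-↭ h hc z (enumerations-↭ (map-enumeration f g fg gf e) e))

countStep : {A : Set} → (A → Bool) → A → ℕ → ℕ
countStep p a n = if p a then suc n else n

countStep-leftComm : {A : Set} (p : A → Bool) → LeftCommutative (countStep p)
countStep-leftComm p a b s with p a | p b
... | true | true = refl
... | true | false = refl
... | false | true = refl
... | false | false = refl

xorStep : {A : Set} → (A → Bool) → A → Bool → Bool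
xorStep f a b = f a xor b

xorStep-leftComm : {A : Set} (f : A → Bool) → LeftCommutative (xorStep f)
xorStep-leftComm f a b s with f a | f b
... | true | true = refl
... | true | false = refl
... | false | true = refl
... | false | false = refl

countB-bijection : {A : Set} (p : A → Bool) {L : List A} → IsEnumeration L
  → (f g : A → A) → (∀ x → f (g x) ≡ x) → (∀ x → g (f x) ≡ x)
  → countB (λ a → p (f a)) L ≡ countB p L
countB-bijection p e f g fg gf = foldr-bijection (countStep p) (countStep-leftComm p) 0 e f g fg gf

module _ {A : Set} (xs : List A) (n : ℕ) where
  prependAll : List A → List (Vec A (suc n))
  prependAll = foldr (λ a acc → map (a ∷_) (allVecsOf xs n) ++ acc) []

  ∈-prependAll : ∀ ys {a v} → a ∈ ys → v ∈ allVecsOf xs n → (a ∷ v) ∈ prependAll ys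
  ∈-prependAll (y ∷ ys) (here refl) q = ∈-++⁺ˡ (∈-map⁺ _ q)
  ∈-prependAll (y ∷ ys) (there p) q = ∈-++⁺ʳ _ (∈-prependAll ys p q)

  prependAll-head : ∀ ys {a v} → (a ∷ v) ∈ prependAll ys → a ∈ ys
  prependAll-head (y ∷ ys) p with ∈-++⁻ (map (y ∷_) (allVecsOf xs n)) p
  ... | inj₁ q with ∈-map⁻ _ q
  ... | _ , _ , refl = here refl
  prependAll-head (y ∷ ys) p | inj₂ q = there (prependAll-head ys q)

  prependAll-unique : ∀ ys → Unique ys → Unique (allVecsOf xs n) → Unique (prependAll ys)
  prependAll-unique [] _ _ = []
  prependAll-unique (y ∷ ys) uy ur = UP.++⁺ (UP.map⁺ inj ur) (prependAll-unique ys (Unique-tail uy) ur) disj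
    where
    inj : ∀ {u v : Vec A n} → (y ∷ u) ≡ (y ∷ v) → u ≡ v
    inj refl = refl
    disj : ∀ {w} → (w ∈ map (y ∷_) (allVecsOf xs n) × w ∈ prependAll ys) → ⊥
    disj (p , q) with ∈-map⁻ _ p
    ... | _ , _ , refl = UP.Unique[x∷xs]⇒x∉xs uy (prependAll-head ys q)

allVecsOf-enumeration : {A : Set} {xs : List A} → IsEnumeration xs → ∀ n → IsEnumeration (allVecsOf xs n)
allVecsOf-enumeration e zero = (All.[] ∷ []) , λ { [] → here refl }
allVecsOf-enumeration {xs = xs} (u , c) (suc n) with allVecsOf-enumeration (u , c) n
... | (ur , cr) = prependAll-unique xs n xs u ur , λ { (a ∷ v) → ∈-prependAll xs n xs (c a) (cr v) }

bools-enumeration : IsEnumeration (false ∷ true ∷ [])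
bools-enumeration = ((λ ()) ∷ []) ∷ [] ∷ [] , λ { false → here refl ; true → there (here refl) }

allVecs-enumeration : ∀ n → IsEnumeration (allVecs n)
allVecs-enumeration = allVecsOf-enumeration bools-enumeration

matrices-enumeration : ∀ N m → IsEnumeration (allVecsOf (allVecs N) m)
matrices-enumeration N = allVecsOf-enumeration (allVecs-enumeration N)

-- Parities and linear combinations over F₂

parity : (n : ℕ) → (Fin n → Bool) → Bool
parity zero f = false
parity (suc n) f = f zero xor parity n (λ i → f (suc i))

xorSum-tabulate : ∀ {A : Set} n (g : A → Bool) (f : Fin n → A) → xorSum g (tabulateL f) ≡ parity n (λ i → g (f i))
xorSum-tabulate zero g f = refl
xorSum-tabulate (suc n) g f = cong (g (f zero) xor_) (xorSum-tabulate n g (λ i → f (suc i)))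

xorSum-allFin : ∀ n (f : Fin n → Bool) → xorSum f (allFinL n) ≡ parity n f
xorSum-allFin n f = xorSum-tabulate n f (λ i → i)

parity-cong : ∀ n {f g : Fin n → Bool} → (∀ i → f i ≡ g i) → parity n f ≡ parity n g
parity-cong zero e = refl
parity-cong (suc n) e = cong₂ _xor_ (e zero) (parity-cong n (λ i → e (suc i)))

parity-xor : ∀ n (f g : Fin n → Bool) → parity n (λ i → f i xor g i) ≡ parity n f xor parity n g
parity-xor zero f g = refl
parity-xor (suc n) f g = trans (cong ((f zero xor g zero) xor_) (parity-xor n _ _))
  (xor-interchange (f zero) (g zero) _ _)

parity-false : ∀ n → parity n (λ _ → false) ≡ false
parity-false zero = refl
parity-false (suc n) = parity-false n

parity-allFalse : ∀ n {f : Fin n → Bool} → (∀ i → f i ≡ false) → parity n f ≡ false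
parity-allFalse n h = trans (parity-cong n h) (parity-false n)

parity-∧ˡ : ∀ n b (f : Fin n → Bool) → parity n (λ i → b ∧ f i) ≡ b ∧ parity n f
parity-∧ˡ n false f = parity-false n
parity-∧ˡ n true f = refl

parity-∧ʳ : ∀ n b (f : Fin n → Bool) → parity n (λ i → f i ∧ b) ≡ parity n f ∧ b
parity-∧ʳ n b f = trans (parity-cong n (λ i → ∧-comm (f i) b)) (trans (parity-∧ˡ n b f) (∧-comm b _))

parity-swap : ∀ n k (f : Fin n → Fin k → Bool)
  → parity n (λ i → parity k (λ j → f i j)) ≡ parity k (λ j → parity n (λ i → f i j))
parity-swap zero k f = sym (parity-false k)
parity-swap (suc n) k f = begin
  parity k (f zero) xor parity n (λ i → parity k (f (suc i)))
    ≡⟨ cong (parity k (f zero) xor_) (parity-swap n k (λ i → f (suc i))) ⟩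
  parity k (f zero) xor parity k (λ j → parity n (λ i → f (suc i) j))
    ≡⟨ sym (parity-xor k _ _) ⟩
  parity k (λ j → f zero j xor parity n (λ i → f (suc i) j)) ∎

δ : ∀ {n} → Fin n → Fin n → Bool
δ zero zero = true
δ zero (suc j) = false
δ (suc i) zero = false
δ (suc i) (suc j) = δ i j

δ-refl : ∀ {n} (i : Fin n) → δ i i ≡ true
δ-refl zero = refl
δ-refl (suc i) = δ-refl i

δ-sym : ∀ {n} (i j : Fin n) → δ i j ≡ δ j i
δ-sym zero zero = refl
δ-sym zero (suc j) = refl
δ-sym (suc i) zero = refl
δ-sym (suc i) (suc j) = δ-sym i j

δ⇒≡ : ∀ {n} (i j : Fin n) → δ i j ≡ true → i ≡ j
δ⇒≡ zero zero e = refl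
δ⇒≡ (suc i) (suc j) e = cong suc (δ⇒≡ i j e)

parity-δ : ∀ n (j : Fin n) (f : Fin n → Bool) → parity n (λ i → δ i j ∧ f i) ≡ f j
parity-δ (suc n) zero f = trans (cong (f zero xor_) (parity-false n)) (BoolP.xor-identityʳ (f zero))
parity-δ (suc n) (suc j) f = parity-δ n j (λ i → f (suc i))

lookup-ext : ∀ {A : Set} {N} {u v : Vec A N} → (∀ j → lookup u j ≡ lookup v j) → u ≡ v
lookup-ext {u = []} {[]} e = refl
lookup-ext {u = x ∷ u} {y ∷ v} e = cong₂ _∷_ (e zero) (lookup-ext (λ j → e (suc j)))

lookup-addV : ∀ {N} (u v : Vec Bool N) j → lookup (addV u v) j ≡ lookup u j xor lookup v j
lookup-addV u v j = lookup-zipWith _xor_ j u v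

lookup-zeroV : ∀ {N} j → lookup (zeroV {N}) j ≡ false
lookup-zeroV {N} j = lookup-replicate j false

lookup-onesV : ∀ {N} j → lookup (onesV {N}) j ≡ true
lookup-onesV {N} j = lookup-replicate j true

linComb : ∀ {n N} → (Fin n → Vec Bool N) → (Fin n → Bool) → Vec Bool N
linComb {n} G c = tabulate (λ j → parity n (λ i → c i ∧ lookup (G i) j))

lookup-linComb : ∀ {n N} (G : Fin n → Vec Bool N) c j → lookup (linComb G c) j ≡ parity n (λ i → c i ∧ lookup (G i) j)
lookup-linComb G c j = lookup∘tabulate _ j

InSpan : ∀ {n N} → (Fin n → Vec Bool N) → Vec Bool N → Set
InSpan {n} G x = Σ (Fin n → Bool) λ c → linComb G c ≡ x

InSpan-gen : ∀ {n N} (G : Fin n → Vec Bool N) i → InSpan G (G i)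
InSpan-gen {n} G i = (λ i' → δ i' i) , lookup-ext (λ j → trans (lookup-linComb G _ j) (parity-δ n i (λ i' → lookup (G i') j)))

InSpan-zeroV : ∀ {n N} (G : Fin n → Vec Bool N) → InSpan G zeroV
InSpan-zeroV {n} G = (λ _ → false) , lookup-ext (λ j → trans (lookup-linComb G _ j) (trans (parity-false n) (sym (lookup-zeroV j))))

InSpan-addV : ∀ {n N} (G : Fin n → Vec Bool N) {x y} → InSpan G x → InSpan G y → InSpan G (addV x y)
InSpan-addV {n} G {x} {y} (c , refl) (d , refl) = (λ i → c i xor d i) , lookup-ext λ j → begin
  lookup (linComb G (λ i → c i xor d i)) j ≡⟨ lookup-linComb G _ j ⟩
  parity n (λ i → (c i xor d i) ∧ lookup (G i) j) ≡⟨ parity-cong n (λ i → ∧-distribʳ-xor (lookup (G i) j) (c i) (d i)) ⟩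
  parity n (λ i → (c i ∧ lookup (G i) j) xor (d i ∧ lookup (G i) j)) ≡⟨ parity-xor n _ _ ⟩
  parity n (λ i → c i ∧ lookup (G i) j) xor parity n (λ i → d i ∧ lookup (G i) j) ≡⟨ sym (cong₂ _xor_ (lookup-linComb G c j) (lookup-linComb G d j)) ⟩
  lookup (linComb G c) j xor lookup (linComb G d) j ≡⟨ sym (lookup-addV (linComb G c) (linComb G d) j) ⟩
  lookup (addV (linComb G c) (linComb G d)) j ∎

InSpan-trans : ∀ {n n' N} (G : Fin n → Vec Bool N) (G' : Fin n' → Vec Bool N)
  → (∀ i' → InSpan G (G' i')) → ∀ {x} → InSpan G' x → InSpan G x
InSpan-trans {n} {n'} G G' h {x} (c , refl) = c'' , lookup-ext λ j → begin
  lookup (linComb G c'') j ≡⟨ lookup-linComb G c'' j ⟩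
  parity n (λ i → parity n' (λ i' → c i' ∧ cs i' i) ∧ lookup (G i) j)
    ≡⟨ parity-cong n (λ i → sym (parity-∧ʳ n' _ _)) ⟩
  parity n (λ i → parity n' (λ i' → (c i' ∧ cs i' i) ∧ lookup (G i) j))
    ≡⟨ parity-swap n n' _ ⟩
  parity n' (λ i' → parity n (λ i → (c i' ∧ cs i' i) ∧ lookup (G i) j))
    ≡⟨ parity-cong n' (λ i' → trans (parity-cong n (λ i → ∧-assoc (c i') _ _)) (parity-∧ˡ n (c i') _)) ⟩
  parity n' (λ i' → c i' ∧ parity n (λ i → cs i' i ∧ lookup (G i) j))
    ≡⟨ parity-cong n' (λ i' → cong (c i' ∧_) (trans (sym (lookup-linComb G (cs i') j)) (cong (λ v → lookup v j) (proj₂ (h i'))))) ⟩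
  parity n' (λ i' → c i' ∧ lookup (G' i') j) ≡⟨ sym (lookup-linComb G' c j) ⟩
  lookup (linComb G' c) j ∎
  where
  cs : Fin n' → Fin n → Bool
  cs i' = proj₁ (h i')
  c'' : Fin n → Bool
  c'' i = parity n' (λ i' → c i' ∧ cs i' i)

lincomb≡linComb : ∀ {k N} (λs : Vec Bool k) (xs : Vec (Vec Bool N) k)
  → lincomb λs xs ≡ linComb (lookup xs) (lookup λs)
lincomb≡linComb [] [] = lookup-ext (λ j → trans (lookup-zeroV j) (sym (lookup-linComb (lookup []) (lookup []) j)))
lincomb≡linComb (false ∷ λs) (x ∷ xs) = trans (lincomb≡linComb λs xs)
  (lookup-ext (λ j → trans (lookup-linComb (lookup xs) (lookup λs) j) (sym (lookup-linComb (lookup (x ∷ xs)) (lookup (false ∷ λs)) j))))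
lincomb≡linComb (true ∷ λs) (x ∷ xs) = lookup-ext λ j → begin
  lookup (addV x (lincomb λs xs)) j ≡⟨ lookup-addV x _ j ⟩
  lookup x j xor lookup (lincomb λs xs) j ≡⟨ cong (λ v → lookup x j xor lookup v j) (lincomb≡linComb λs xs) ⟩
  lookup x j xor lookup (linComb (lookup xs) (lookup λs)) j ≡⟨ cong (lookup x j xor_) (lookup-linComb (lookup xs) (lookup λs) j) ⟩
  lookup x j xor parity _ (λ i → lookup λs i ∧ lookup (lookup xs i) j) ≡⟨ sym (lookup-linComb (lookup (x ∷ xs)) (lookup (true ∷ λs)) j) ⟩
  lookup (linComb (lookup (x ∷ xs)) (lookup (true ∷ λs))) j ∎

true≢false : true ≢ false
true≢false ()

bool-ext : ∀ {a b : Bool} → (a ≡ true → b ≡ true) → (b ≡ true → a ≡ true) → a ≡ b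
bool-ext {false} {false} f g = refl
bool-ext {false} {true} f g = g refl
bool-ext {true} {false} f g = sym (f refl)
bool-ext {true} {true} f g = refl

⌊⌋-sound : ∀ {P : Set} (d : Dec P) → ⌊ d ⌋ ≡ true → P
⌊⌋-sound (yes p) _ = p

⌊⌋-complete : ∀ {P : Set} (d : Dec P) → P → ⌊ d ⌋ ≡ true
⌊⌋-complete (yes p) _ = refl
⌊⌋-complete (no ¬p) p = ⊥-elim (¬p p)

eqV-sound : ∀ {n} {u v : Vec Bool n} → eqV u v ≡ true → u ≡ v
eqV-sound {u = u} {v} = ⌊⌋-sound (VecP.≡-dec BoolP._≟_ u v)

eqV-complete : ∀ {n} {u v : Vec Bool n} → u ≡ v → eqV u v ≡ true
eqV-complete {u = u} {v} = ⌊⌋-complete (VecP.≡-dec BoolP._≟_ u v)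

true-∧ : ∀ {a b} → a ≡ true → b ≡ true → a ∧ b ≡ true
true-∧ refl refl = refl

anyL-sound : ∀ {A : Set} (f : A → Bool) (L : List A) → anyL f L ≡ true → ∃ λ a → a ∈ L × f a ≡ true
anyL-sound f (a ∷ L) e with f a in eq
... | true = a , here refl , eq
... | false with anyL-sound f L e
... | b , b∈ , fb = b , there b∈ , fb

anyL-complete : ∀ {A : Set} (f : A → Bool) (L : List A) {a} → a ∈ L → f a ≡ true → anyL f L ≡ true
anyL-complete f (b ∷ L) (here refl) e rewrite e = refl
anyL-complete f (b ∷ L) (there p) e with f b
... | true = refl
... | false = anyL-complete f L p e

allL-sound : ∀ {A : Set} (f : A → Bool) (L : List A) → allL f L ≡ true → ∀ {a} → a ∈ L → f a ≡ true
allL-sound f (b ∷ L) e (here refl) = BoolP.∧-conicalˡ _ _ e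
allL-sound f (b ∷ L) e (there p) = allL-sound f L (BoolP.∧-conicalʳ (f b) _ e) p

allL-complete : ∀ {A : Set} (f : A → Bool) (L : List A) → (∀ {a} → a ∈ L → f a ≡ true) → allL f L ≡ true
allL-complete f [] h = refl
allL-complete f (b ∷ L) h = true-∧ (h (here refl)) (allL-complete f L (λ p → h (there p)))

lookup-applyM : ∀ {m} (A : Fin m → Fin m → Bool) v i → lookup (applyM A v) i ≡ parity m (λ k → A i k ∧ lookup v k)
lookup-applyM {m} A v i = trans (lookup∘tabulate _ i) (xorSum-allFin m _)

applyM-addV : ∀ {m} (A : Fin m → Fin m → Bool) u v → applyM A (addV u v) ≡ addV (applyM A u) (applyM A v)
applyM-addV {m} A u v = lookup-ext λ i → begin
  lookup (applyM A (addV u v)) i ≡⟨ lookup-applyM A (addV u v) i ⟩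
  parity m (λ k → A i k ∧ lookup (addV u v) k) ≡⟨ parity-cong m (λ k → trans (cong (A i k ∧_) (lookup-addV u v k)) (∧-distribˡ-xor (A i k) _ _)) ⟩
  parity m (λ k → (A i k ∧ lookup u k) xor (A i k ∧ lookup v k)) ≡⟨ parity-xor m _ _ ⟩
  parity m (λ k → A i k ∧ lookup u k) xor parity m (λ k → A i k ∧ lookup v k) ≡⟨ sym (cong₂ _xor_ (lookup-applyM A u i) (lookup-applyM A v i)) ⟩
  lookup (applyM A u) i xor lookup (applyM A v) i ≡⟨ sym (lookup-addV (applyM A u) (applyM A v) i) ⟩
  lookup (addV (applyM A u) (applyM A v)) i ∎

addV-cancelʳ : ∀ {n} (u b : Vec Bool n) → addV (addV u b) b ≡ u
addV-cancelʳ u b = lookup-ext λ j → trans (lookup-addV (addV u b) b j) (trans (cong (_xor lookup b j) (lookup-addV u b j))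
  (trans (xor-assoc (lookup u j) _ _) (trans (cong (lookup u j xor_) (xor-same (lookup b j))) (BoolP.xor-identityʳ _))))

-- Matrices, the codes they span and their exponents

Matrix : ℕ → ℕ → Set
Matrix m N = Vec (Vec Bool N) m

col : ∀ {m N} → Matrix m N → Fin N → Vec Bool m
col M j = mapV (λ row → lookup row j) M

lookup-col : ∀ {m N} (M : Matrix m N) j i → lookup (col M j) i ≡ lookup (lookup M i) j
lookup-col M j i = lookup-map i (λ row → lookup row j) M

colMap : ∀ {m N} → (Vec Bool m → Vec Bool m) → Matrix m N → Matrix m N
colMap g M = tabulate (λ i → tabulate (λ j → lookup (g (col M j)) i))

col-colMap : ∀ {m N} (g : Vec Bool m → Vec Bool m) (M : Matrix m N) j → col (colMap g M) j ≡ g (col M j)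
col-colMap g M j = lookup-ext λ i → trans (lookup-col (colMap g M) j i)
  (trans (cong (λ r → lookup r j) (lookup∘tabulate (λ i → tabulate (λ j → lookup (g (col M j)) i)) i))
    (lookup∘tabulate (λ j → lookup (g (col M j)) i) j))

matrix-ext : ∀ {m N} {M M' : Matrix m N} → (∀ j → col M j ≡ col M' j) → M ≡ M'
matrix-ext {M = M} {M'} h = lookup-ext λ i → lookup-ext λ j → trans (sym (lookup-col M j i)) (trans (cong (λ c → lookup c i) (h j)) (lookup-col M' j i))

colMap-cong : ∀ {m N} {g h : Vec Bool m → Vec Bool m} → (∀ v → g v ≡ h v) → (M : Matrix m N) → colMap g M ≡ colMap h M
colMap-cong {g = g} {h} e M = matrix-ext λ j → trans (col-colMap g M j) (trans (e _) (sym (col-colMap h M j)))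

colMap-∘ : ∀ {m N} (g h : Vec Bool m → Vec Bool m) (M : Matrix m N) → colMap g (colMap h M) ≡ colMap (λ v → g (h v)) M
colMap-∘ g h M = matrix-ext λ j → trans (col-colMap g (colMap h M) j) (trans (cong g (col-colMap h M j)) (sym (col-colMap (λ v → g (h v)) M j)))

colMap-id : ∀ {m N} (g : Vec Bool m → Vec Bool m) → (∀ v → g v ≡ v) → (M : Matrix m N) → colMap g M ≡ M
colMap-id g e M = matrix-ext λ j → trans (col-colMap g M j) (e _)

generators : ∀ {m N} → Matrix m N → Fin (suc m) → Vec Bool N
generators M = lookup (onesV ∷ M)

GeneratorsOrthogonal : ∀ {m N} → Matrix m N → Set
GeneratorsOrthogonal M = ∀ i i' → dot (generators M i) (generators M i') ≡ false

codeOf : ∀ {m N} → Matrix m N → Vec Bool N → Bool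
codeOf {m} M x = anyL (λ λs → eqV (lincomb λs (onesV ∷ M)) x) (allVecs (suc m))

linComb-cong : ∀ {n N} (G : Fin n → Vec Bool N) {c c'} → (∀ i → c i ≡ c' i) → linComb G c ≡ linComb G c'
linComb-cong {n} G e = tabulate-cong (λ j → parity-cong n (λ i → cong (_∧ _) (e i)))

codeOf-sound : ∀ {m N} (M : Matrix m N) x → codeOf M x ≡ true → InSpan (generators M) x
codeOf-sound {m} M x e with anyL-sound _ (allVecs (suc m)) e
... | λs , _ , q = lookup λs , trans (sym (lincomb≡linComb λs (onesV ∷ M))) (eqV-sound q)

codeOf-complete : ∀ {m N} (M : Matrix m N) x → InSpan (generators M) x → codeOf M x ≡ true
codeOf-complete {m} M x (c , refl) = anyL-complete _ (allVecs (suc m)) (proj₂ (allVecs-enumeration (suc m)) (tabulate c))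
  (eqV-complete (trans (lincomb≡linComb (tabulate c) (onesV ∷ M)) (linComb-cong (generators M) (lookup∘tabulate c))))

codeOf-cong : ∀ {m N} (M M' : Matrix m N) → (∀ {x} → InSpan (generators M) x → InSpan (generators M') x)
  → (∀ {x} → InSpan (generators M') x → InSpan (generators M) x) → ∀ x → codeOf M x ≡ codeOf M' x
codeOf-cong M M' f g x = bool-ext (λ e → codeOf-complete M' x (f (codeOf-sound M x e)))
  (λ e → codeOf-complete M x (g (codeOf-sound M' x e)))

-- Field-independent copies of Poly.spansWithOne and Poly.hasExp: μ is a count
-- of matrices satisfying both.
spans : ∀ {m N} → Matrix m N → Code N → Bool
spans {m} {N} M C = allL (λ x → ⌊ BoolP._≟_ (C x)
      (anyL (λ λs → eqV (lincomb λs (onesV ∷ M)) x) (allVecs (suc m))) ⌋) (allVecs N)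

spans-sound : ∀ {m N} (M : Matrix m N) C → spans M C ≡ true → ∀ x → C x ≡ codeOf M x
spans-sound {m} {N} M C e x = ⌊⌋-sound (BoolP._≟_ (C x) _) (allL-sound _ (allVecs N) e (proj₂ (allVecs-enumeration N) x))

spans-complete : ∀ {m N} (M : Matrix m N) C → (∀ x → C x ≡ codeOf M x) → spans M C ≡ true
spans-complete {m} {N} M C h = allL-complete _ (allVecs N) (λ {x} _ → ⌊⌋-complete (BoolP._≟_ (C x) _) (h x))

spans-cong : ∀ {m N} (M M' : Matrix m N) C → (∀ x → codeOf M x ≡ codeOf M' x) → spans M C ≡ spans M' C
spans-cong M M' C h = bool-ext (λ e → spans-complete M' C (λ x → trans (spans-sound M C e x) (h x)))
  (λ e → spans-complete M C (λ x → trans (spans-sound M' C e x) (sym (h x))))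

exponent : ∀ {m N} → Matrix m N → Vec Bool m → ℕ
exponent {m} {N} M v = countB (λ j → eqV (col M j) v) (allFinL N)

hasExponent : ∀ {m N} → Matrix m N → (Vec Bool m → ℕ) → Bool
hasExponent {m} {N} M e = allL (λ v → e v ≡ᵇ countB (λ j → eqV (col M j) v) (allFinL N)) (allVecs m)

≡true⇒T : ∀ {b} → b ≡ true → T b
≡true⇒T refl = _

T⇒≡true : ∀ {b} → T b → b ≡ true
T⇒≡true {true} _ = refl

hasExponent-sound : ∀ {m N} (M : Matrix m N) e → hasExponent M e ≡ true → ∀ v → e v ≡ exponent M v
hasExponent-sound {m} M e h v = NatP.≡ᵇ⇒≡ (e v) _ (≡true⇒T (allL-sound _ (allVecs m) h (proj₂ (allVecs-enumeration m) v)))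

hasExponent-complete : ∀ {m N} (M : Matrix m N) e → (∀ v → e v ≡ exponent M v) → hasExponent M e ≡ true
hasExponent-complete {m} M e h = allL-complete _ (allVecs m) (λ {v} _ → T⇒≡true (NatP.≡⇒≡ᵇ (e v) _ (h v)))

-- Affine maps acting on columns

affine : ∀ {m} → (Fin m → Fin m → Bool) → Vec Bool m → Vec Bool m → Vec Bool m
affine A b v = addV (applyM A v) b

affine-generators-inSpan : ∀ {m N} (A : Fin m → Fin m → Bool) b (M : Matrix m N) i' → InSpan (generators M) (generators (colMap (affine A b) M) i')
affine-generators-inSpan A b M zero = InSpan-gen (generators M) zero
affine-generators-inSpan {m} A b M (suc i) = c , lookup-ext λ j → begin
  lookup (linComb (generators M) c) j ≡⟨ lookup-linComb (generators M) c j ⟩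
  (lookup b i ∧ lookup onesV j) xor parity m (λ k → A i k ∧ lookup (lookup M k) j)
    ≡⟨ cong₂ _xor_ (trans (cong (lookup b i ∧_) (lookup-onesV j)) (BoolP.∧-identityʳ _))
         (parity-cong m (λ k → cong (A i k ∧_) (sym (lookup-col M j k)))) ⟩
  lookup b i xor parity m (λ k → A i k ∧ lookup (col M j) k)
    ≡⟨ xor-comm (lookup b i) _ ⟩
  parity m (λ k → A i k ∧ lookup (col M j) k) xor lookup b i
    ≡⟨ cong (_xor lookup b i) (sym (lookup-applyM A (col M j) i)) ⟩
  lookup (applyM A (col M j)) i xor lookup b i ≡⟨ sym (lookup-addV (applyM A (col M j)) b i) ⟩
  lookup (affine A b (col M j)) i ≡⟨ sym (lookup∘tabulate (λ j → lookup (affine A b (col M j)) i) j) ⟩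
  lookup (tabulate (λ j → lookup (affine A b (col M j)) i)) j
    ≡⟨ cong (λ r → lookup r j) (sym (lookup∘tabulate (λ i → tabulate (λ j → lookup (affine A b (col M j)) i)) i)) ⟩
  lookup (generators (colMap (affine A b) M) (suc i)) j ∎
  where
  c : Fin (suc _) → Bool
  c zero = lookup b i
  c (suc k) = A i k

InSpan-colMap-affine : ∀ {m N} (A : Fin m → Fin m → Bool) b (M : Matrix m N) {x}
  → InSpan (generators (colMap (affine A b) M)) x → InSpan (generators M) x
InSpan-colMap-affine A b M = InSpan-trans (generators M) (generators (colMap (affine A b) M)) (affine-generators-inSpan A b M)

module AffineBijection {m : ℕ} (A B : Fin m → Fin m → Bool) (b : Vec Bool m)
  (BA : ∀ v → applyM B (applyM A v) ≡ v) (AB : ∀ v → applyM A (applyM B v) ≡ v) where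

  g : Vec Bool m → Vec Bool m
  g = affine A b
  h : Vec Bool m → Vec Bool m
  h w = applyM B (addV w b)

  gh : ∀ w → g (h w) ≡ w
  gh w = trans (cong (λ z → addV z b) (AB (addV w b))) (addV-cancelʳ w b)

  hg : ∀ v → h (g v) ≡ v
  hg v = trans (cong (applyM B) (addV-cancelʳ (applyM A v) b)) (BA v)

  h-aff : ∀ w → h w ≡ affine B (applyM B b) w
  h-aff w = applyM-addV B w b

  Φ Ψ : ∀ {N} → Matrix m N → Matrix m N
  Φ = colMap g
  Ψ = colMap h

  ΦΨ : ∀ {N} (M : Matrix m N) → Φ (Ψ M) ≡ M
  ΦΨ M = trans (colMap-∘ g h M) (colMap-id _ gh M)
  ΨΦ : ∀ {N} (M : Matrix m N) → Ψ (Φ M) ≡ M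
  ΨΦ M = trans (colMap-∘ h g M) (colMap-id _ hg M)

  codeOf-Φ : ∀ {N} (M : Matrix m N) x → codeOf (Φ M) x ≡ codeOf M x
  codeOf-Φ M = codeOf-cong (Φ M) M (InSpan-colMap-affine A b M) back
    where
    back : ∀ {x} → InSpan (generators M) x → InSpan (generators (Φ M)) x
    back {x} p = InSpan-colMap-affine B (applyM B b) (Φ M)
      (subst (λ M' → InSpan (generators M') x) (sym (trans (colMap-cong (λ w → sym (h-aff w)) (Φ M)) (ΨΦ M))) p)

  eqV-g : ∀ c w → eqV (g c) w ≡ eqV c (h w)
  eqV-g c w = bool-ext (λ e → eqV-complete (trans (sym (hg c)) (cong h (eqV-sound e))))
                     (λ e → eqV-complete (trans (cong g (eqV-sound e)) (gh w)))

countB-cong : ∀ {A : Set} {p q : A → Bool} (L : List A) → (∀ a → p a ≡ q a) → countB p L ≡ countB q L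
countB-cong [] e = refl
countB-cong (a ∷ L) e rewrite e a | countB-cong L e = refl

module AffineInvariance {m : ℕ} (A B : Fin m → Fin m → Bool) (b : Vec Bool m)
  (BA : ∀ v → applyM B (applyM A v) ≡ v) (AB : ∀ v → applyM A (applyM B v) ≡ v) where
  open AffineBijection A B b BA AB

  exponent-Φ : ∀ {N} (M : Matrix m N) w → exponent (Φ M) w ≡ exponent M (h w)
  exponent-Φ {N} M w = countB-cong (allFinL N) (λ j → trans (cong (λ c → eqV c w) (col-colMap g M j)) (eqV-g (col M j) w))

  hasExponent-Φ : ∀ {N} (M : Matrix m N) (e : Vec Bool m → ℕ) → hasExponent M (λ v → e (g v)) ≡ hasExponent (Φ M) e
  hasExponent-Φ M e = bool-ext
    (λ t → hasExponent-complete (Φ M) e (λ w → trans (sym (cong e (gh w))) (trans (hasExponent-sound M (λ v → e (g v)) t (h w)) (sym (exponent-Φ M w)))))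
    (λ t → hasExponent-complete M (λ v → e (g v)) (λ v → trans (hasExponent-sound (Φ M) e t (g v)) (trans (exponent-Φ M (g v)) (cong (exponent M) (hg v)))))

  countB-affine-invariant : ∀ {N} (C : Code N) (e : Vec Bool m → ℕ)
    → countB (λ M → spans M C ∧ hasExponent M (λ v → e (g v))) (allVecsOf (allVecs N) m)
      ≡ countB (λ M → spans M C ∧ hasExponent M e) (allVecsOf (allVecs N) m)
  countB-affine-invariant {N} C e = trans (countB-cong (allVecsOf (allVecs N) m)
      (λ M → cong₂ _∧_ (sym (spans-cong (Φ M) M C (codeOf-Φ M))) (hasExponent-Φ M e)))
    (countB-bijection (λ M → spans M C ∧ hasExponent M e) (matrices-enumeration N m) Φ Ψ ΦΨ ΨΦ)

-- Parities and sizes of exponents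

xorSum-cong : ∀ {A : Set} {f g : A → Bool} (L : List A) → (∀ a → f a ≡ g a) → xorSum f L ≡ xorSum g L
xorSum-cong [] e = refl
xorSum-cong (a ∷ L) e = cong₂ _xor_ (e a) (xorSum-cong L e)

xorSum-parity : ∀ {A : Set} (L : List A) n (f : A → Fin n → Bool)
  → xorSum (λ a → parity n (f a)) L ≡ parity n (λ j → xorSum (λ a → f a j) L)
xorSum-parity [] n f = sym (parity-false n)
xorSum-parity (a ∷ L) n f = trans (cong (parity n (f a) xor_) (xorSum-parity L n f)) (sym (parity-xor n _ _))

xorSum-false : ∀ {A : Set} (f : A → Bool) (L : List A) → (∀ {a} → a ∈ L → f a ≡ false) → xorSum f L ≡ false
xorSum-false f [] h = refl
xorSum-false f (a ∷ L) h = trans (cong₂ _xor_ (h (here refl)) (xorSum-false f L (λ p → h (there p)))) refl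

countB-zero : ∀ {A : Set} (f : A → Bool) (L : List A) → (∀ {a} → a ∈ L → f a ≡ false) → countB f L ≡ 0
countB-zero f [] h = refl
countB-zero f (a ∷ L) h rewrite h (here refl) = countB-zero f L (λ p → h (there p))

module SingleElement {A : Set} {L : List A} (E : IsEnumeration L) (c : A) where
  split : ∃ λ as → ∃ λ bs → L ≡ as ++ c ∷ bs
  split with ∈-∃++ (proj₂ E c)
  ... | as , bs , eq = as , bs , eq

  xorSum-single : (f : A → Bool) → (∀ a → a ≢ c → f a ≡ false) → xorSum f L ≡ f c
  xorSum-single f h with split
  ... | as , bs , refl = trans (foldr-↭ (xorStep f) (xorStep-leftComm f) false (shift c as bs))
      (trans (cong (f c xor_) (xorSum-false f (as ++ bs) (λ {a} p → h a (λ { refl → proj₂ (Unique-dropMiddle as (proj₁ E)) p }))))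
        (BoolP.xor-identityʳ _))

  countB-single : (f : A → Bool) → (∀ a → a ≢ c → f a ≡ false) → f c ≡ true → countB f L ≡ 1
  countB-single f h fc with split
  ... | as , bs , refl = trans (foldr-↭ (countStep f) (countStep-leftComm f) 0 (shift c as bs))
      (trans (cong (λ b → if b then suc (countB f (as ++ bs)) else countB f (as ++ bs)) fc)
        (cong suc (countB-zero f (as ++ bs) (λ {a} p → h a (λ { refl → proj₂ (Unique-dropMiddle as (proj₁ E)) p })))))

≢⇒eqV-false : ∀ {n} (u v : Vec Bool n) → v ≢ u → eqV u v ≡ false
≢⇒eqV-false u v ne with eqV u v in e
... | true = ⊥-elim (ne (sym (eqV-sound e)))
... | false = refl

oddℕ-countB : ∀ {A : Set} (p : A → Bool) (L : List A) → oddℕ (countB p L) ≡ xorSum p L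
oddℕ-countB p [] = refl
oddℕ-countB p (a ∷ L) with p a
... | true = cong not (oddℕ-countB p L)
... | false = oddℕ-countB p L

oddExponent-parity : ∀ {m N} (M : Matrix m N) (f : Vec Bool m → Bool)
  → xorSum (λ v → oddℕ (exponent M v) ∧ f v) (allVecs m) ≡ parity N (λ j → f (col M j))
oddExponent-parity {m} {N} M f = begin
  xorSum (λ v → oddℕ (exponent M v) ∧ f v) (allVecs m)
    ≡⟨ xorSum-cong (allVecs m) (λ v → cong (_∧ f v) (trans (oddℕ-countB _ (allFinL N)) (xorSum-allFin N _))) ⟩
  xorSum (λ v → parity N (λ j → eqV (col M j) v) ∧ f v) (allVecs m)
    ≡⟨ xorSum-cong (allVecs m) (λ v → sym (parity-∧ʳ N (f v) _)) ⟩
  xorSum (λ v → parity N (λ j → eqV (col M j) v ∧ f v)) (allVecs m)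
    ≡⟨ xorSum-parity (allVecs m) N _ ⟩
  parity N (λ j → xorSum (λ v → eqV (col M j) v ∧ f v) (allVecs m))
    ≡⟨ parity-cong N (λ j → trans (SingleElement.xorSum-single (allVecs-enumeration m) (col M j) _
          (λ v ne → cong (_∧ f v) (≢⇒eqV-false (col M j) v ne)))
          (cong (_∧ f (col M j)) (eqV-complete refl))) ⟩
  parity N (λ j → f (col M j)) ∎

sumL : ∀ {A : Set} → (A → ℕ) → List A → ℕ
sumL f = foldr (λ a n → f a + n) 0

countFin : (n : ℕ) → (Fin n → Bool) → ℕ
countFin zero f = 0
countFin (suc n) f = (if f zero then 1 else 0) + countFin n (λ i → f (suc i))

countB-tabulate : ∀ {A : Set} n (g : A → Bool) (f : Fin n → A) → countB g (Data.List.tabulate f) ≡ countFin n (λ i → g (f i))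
countB-tabulate zero g f = refl
countB-tabulate (suc n) g f with g (f zero)
... | true = cong suc (countB-tabulate n g (λ i → f (suc i)))
... | false = countB-tabulate n g (λ i → f (suc i))

countB-allFin : ∀ n (f : Fin n → Bool) → countB f (allFinL n) ≡ countFin n f
countB-allFin n f = countB-tabulate n f (λ i → i)

countB-sumL : ∀ {A : Set} (p : A → Bool) (L : List A) → countB p L ≡ sumL (λ a → if p a then 1 else 0) L
countB-sumL p [] = refl
countB-sumL p (a ∷ L) with p a
... | true = cong suc (countB-sumL p L)
... | false = countB-sumL p L

sumL-+ : ∀ {A : Set} (f g : A → ℕ) (L : List A) → sumL (λ a → f a + g a) L ≡ sumL f L + sumL g L
sumL-+ f g [] = refl
sumL-+ f g (a ∷ L) rewrite sumL-+ f g L = +-interchange (f a) (g a) (sumL f L) (sumL g L)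

sumL-cong : ∀ {A : Set} {f g : A → ℕ} (L : List A) → (∀ a → f a ≡ g a) → sumL f L ≡ sumL g L
sumL-cong [] e = refl
sumL-cong (a ∷ L) e = cong₂ _+_ (e a) (sumL-cong L e)

sumL-0 : ∀ {A : Set} (L : List A) → sumL (λ _ → 0) L ≡ 0
sumL-0 [] = refl
sumL-0 (a ∷ L) = sumL-0 L

sumFin : (n : ℕ) → (Fin n → ℕ) → ℕ
sumFin zero f = 0
sumFin (suc n) f = f zero + sumFin n (λ i → f (suc i))

sumL-countFin : ∀ {A : Set} (L : List A) n (q : Fin n → A → Bool)
  → sumL (λ a → countFin n (λ j → q j a)) L ≡ sumFin n (λ j → sumL (λ a → if q j a then 1 else 0) L)
sumL-countFin L zero q = sumL-0 L
sumL-countFin L (suc n) q = trans (sumL-+ _ _ L) (cong (sumL (λ a → if q zero a then 1 else 0) L +_) (sumL-countFin L n (λ j → q (suc j))))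

deg-exponent : ∀ {m N} (M : Matrix m N) → deg (exponent M) ≡ N
deg-exponent {m} {N} M = begin
  deg (exponent M) ≡⟨ sumL-cong (allVecs m) (λ v → countB-allFin N _) ⟩
  sumL (λ v → countFin N (λ j → eqV (col M j) v)) (allVecs m) ≡⟨ sumL-countFin (allVecs m) N _ ⟩
  sumFin N (λ j → sumL (λ v → if eqV (col M j) v then 1 else 0) (allVecs m)) ≡⟨ sumFin-cong N (λ j →
     trans (sym (countB-sumL _ (allVecs m))) (SingleElement.countB-single (allVecs-enumeration m) (col M j) _
        (λ v ne → ≢⇒eqV-false (col M j) v ne) (eqV-complete refl))) ⟩
  sumFin N (λ _ → 1) ≡⟨ sumFin-1 N ⟩
  N ∎
  where
  sumFin-cong : ∀ n {f g : Fin n → ℕ} → (∀ i → f i ≡ g i) → sumFin n f ≡ sumFin n g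
  sumFin-cong zero e = refl
  sumFin-cong (suc n) e = cong₂ _+_ (e zero) (sumFin-cong n (λ i → e (suc i)))
  sumFin-1 : ∀ n → sumFin n (λ _ → 1) ≡ n
  sumFin-1 zero = refl
  sumFin-1 (suc n) = cong suc (sumFin-1 n)

deg-cong : ∀ {m} (e e' : Vec Bool m → ℕ) → (∀ v → e v ≡ e' v) → deg e ≡ deg e'
deg-cong {m} e e' h = sumL-cong (allVecs m) h

-- Quadratic forms evaluated on the columns of a matrix

dot-parity : ∀ {N} (x y : Vec Bool N) → dot x y ≡ parity N (λ j → lookup x j ∧ lookup y j)
dot-parity [] [] = refl
dot-parity (a ∷ x) (b ∷ y) = cong ((a ∧ b) xor_) (dot-parity x y)

dot-sym : ∀ {N} (x y : Vec Bool N) → dot x y ≡ dot y x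
dot-sym {N} x y = trans (dot-parity x y) (trans (parity-cong N (λ j → ∧-comm (lookup x j) _)) (sym (dot-parity y x)))

quadForm-parity : ∀ {m} (c : Fin m → Fin m → Bool) v
  → quadForm c v ≡ parity m (λ i → parity m (λ i' → ((toℕ i ≤ᵇ toℕ i') ∧ c i i') ∧ (lookup v i ∧ lookup v i')))
quadForm-parity {m} c v = trans (xorSum-allFin m _) (parity-cong m (λ i → trans (xorSum-allFin m _)
  (parity-cong m (λ i' → sym (∧-assoc (toℕ i ≤ᵇ toℕ i') _ _)))))

upperCoeff : ∀ {m} → (Fin m → Fin m → Bool) → Fin m → Fin m → Bool
upperCoeff c i i' = (toℕ i ≤ᵇ toℕ i') ∧ c i i'

quadForm-columns-parity : ∀ {m N} (M : Matrix m N) (c : Fin m → Fin m → Bool) a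
  → parity N (λ j → quadForm c (col M j) xor a)
    ≡ parity m (λ i → parity m (λ i' → upperCoeff c i i' ∧ dot (lookup M i) (lookup M i'))) xor (a ∧ dot (onesV {N}) onesV)
quadForm-columns-parity {m} {N} M c a = begin
  parity N (λ j → quadForm c (col M j) xor a) ≡⟨ parity-xor N _ _ ⟩
  parity N (λ j → quadForm c (col M j)) xor parity N (λ _ → a) ≡⟨ cong₂ _xor_ part1 part2 ⟩
  parity m (λ i → parity m (λ i' → upperCoeff c i i' ∧ dot (lookup M i) (lookup M i'))) xor (a ∧ dot (onesV {N}) onesV) ∎
  where
  part2 : parity N (λ _ → a) ≡ a ∧ dot (onesV {N}) onesV
  part2 = trans (parity-cong N (λ j → sym (BoolP.∧-identityʳ a))) (trans (parity-∧ˡ N a (λ _ → true))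
    (cong (a ∧_) (sym (trans (dot-parity (onesV {N}) onesV) (parity-cong N (λ j → cong₂ _∧_ (lookup-onesV j) (lookup-onesV j)))))))
  part1 : parity N (λ j → quadForm c (col M j)) ≡ parity m (λ i → parity m (λ i' → upperCoeff c i i' ∧ dot (lookup M i) (lookup M i')))
  part1 = begin
    parity N (λ j → quadForm c (col M j)) ≡⟨ parity-cong N (λ j → quadForm-parity c (col M j)) ⟩
    parity N (λ j → parity m (λ i → parity m (λ i' → upperCoeff c i i' ∧ (lookup (col M j) i ∧ lookup (col M j) i'))))
      ≡⟨ parity-swap N m _ ⟩
    parity m (λ i → parity N (λ j → parity m (λ i' → upperCoeff c i i' ∧ (lookup (col M j) i ∧ lookup (col M j) i'))))
      ≡⟨ parity-cong m (λ i → parity-swap N m _) ⟩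
    parity m (λ i → parity m (λ i' → parity N (λ j → upperCoeff c i i' ∧ (lookup (col M j) i ∧ lookup (col M j) i'))))
      ≡⟨ parity-cong m (λ i → parity-cong m (λ i' → trans (parity-∧ˡ N (upperCoeff c i i') _) (cong (upperCoeff c i i' ∧_)
           (trans (parity-cong N (λ j → cong₂ _∧_ (lookup-col M j i) (lookup-col M j i'))) (sym (dot-parity (lookup M i) (lookup M i'))))))) ⟩
    parity m (λ i → parity m (λ i' → upperCoeff c i i' ∧ dot (lookup M i) (lookup M i'))) ∎

orthogonal⇒parity-false : ∀ {m N} (M : Matrix m N) → GeneratorsOrthogonal M
  → ∀ c a → parity N (λ j → quadForm c (col M j) xor a) ≡ false
orthogonal⇒parity-false {m} {N} M h c a = trans (quadForm-columns-parity M c a) (cong₂ _xor_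
  (parity-allFalse m (λ i → parity-allFalse m (λ i' →
    trans (cong (upperCoeff c i i' ∧_) (h (suc i) (suc i'))) (BoolP.∧-zeroʳ (upperCoeff c i i')))))
  (trans (cong (a ∧_) (h zero zero)) (BoolP.∧-zeroʳ a)))

∧-rearrange : ∀ x y z d → (x ∧ (y ∧ z)) ∧ d ≡ y ∧ (z ∧ (x ∧ d))
∧-rearrange false false z d = refl
∧-rearrange false true false d = refl
∧-rearrange false true true d = refl
∧-rearrange true false z d = refl
∧-rearrange true true false d = refl
∧-rearrange true true true d = refl

elementaryForm : ∀ {m} → Fin m → Fin m → Fin m → Fin m → Bool
elementaryForm i i' k k' = δ k i ∧ δ k' i'

elementaryForm-parity : ∀ {m N} (M : Matrix m N) (i i' : Fin m)
  → parity N (λ j → quadForm (elementaryForm i i') (col M j) xor false) ≡ (toℕ i ≤ᵇ toℕ i') ∧ dot (lookup M i) (lookup M i')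
elementaryForm-parity {m} M i i' = trans (quadForm-columns-parity M (elementaryForm i i') false) (trans (BoolP.xor-identityʳ _)
  (trans (parity-cong m (λ k → parity-cong m (λ k' → ∧-rearrange (toℕ k ≤ᵇ toℕ k') (δ k i) (δ k' i') _)))
  (trans (parity-cong m (λ k → parity-∧ˡ m (δ k i) _)) (trans (parity-δ m i _) (parity-δ m i' _)))))

≤⇒≤ᵇ-true : ∀ a b → a ≤ b → (a ≤ᵇ b) ≡ true
≤⇒≤ᵇ-true a b le = T⇒≡true (NatP.≤⇒≤ᵇ le)

-- An odd inner product of rows i, i' is detected by the form v_i v_i', one of a
-- row with 1 by v_i², and dot 1 1 = N mod 2 by the constant form a = 1.
nonOrthogonal⇒oddParity : ∀ {m N} (M : Matrix m N) i i' → dot (generators M i) (generators M i') ≡ true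
  → ∃ λ c → ∃ λ a → parity N (λ j → quadForm c (col M j) xor a) ≡ true
nonOrthogonal⇒oddParity {m} {N} M zero zero h = (λ _ _ → false) , true , trans (quadForm-columns-parity M _ true) (trans (cong₂ _xor_
  (parity-allFalse m (λ i → parity-allFalse m (λ i' →
    cong (_∧ dot (lookup M i) (lookup M i')) (BoolP.∧-zeroʳ (toℕ i ≤ᵇ toℕ i'))))) h) refl)
nonOrthogonal⇒oddParity {m} {N} M zero (suc i) h = elementaryForm i i , false , trans (elementaryForm-parity M i i)
  (trans (cong (_∧ dot (lookup M i) (lookup M i)) (≤⇒≤ᵇ-true (toℕ i) (toℕ i) NatP.≤-refl)) (trans (trans (dot-parity (lookup M i) _)
    (trans (parity-cong N (λ j → trans (BoolP.∧-idem (lookup (lookup M i) j)) (sym (cong (_∧ lookup (lookup M i) j) (lookup-onesV j))))) (sym (dot-parity onesV (lookup M i))))) h))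
nonOrthogonal⇒oddParity M (suc i) zero h = nonOrthogonal⇒oddParity M zero (suc i) (trans (dot-sym onesV (lookup M i)) h)
nonOrthogonal⇒oddParity M (suc i) (suc i') h with NatP.≤-total (toℕ i) (toℕ i')
... | inj₁ le = elementaryForm i i' , false , trans (elementaryForm-parity M i i') (trans (cong (_∧ dot (lookup M i) (lookup M i')) (≤⇒≤ᵇ-true _ _ le)) h)
... | inj₂ le = elementaryForm i' i , false , trans (elementaryForm-parity M i' i)
  (trans (cong (_∧ dot (lookup M i') (lookup M i)) (≤⇒≤ᵇ-true _ _ le)) (trans (dot-sym (lookup M i') (lookup M i)) h))

-- The polynomials μ(C) are invariant

module Invariance {c ℓ : Level} (K : CharZeroField c ℓ) (m : ℕ) where
  open CharZeroField K hiding (refl; sym; trans)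
  open CharZeroField K using () renaming (refl to ≈-refl; trans to ≈-trans)
  open Poly K m
  open RingProps ring using (-0#≈0#)

  matrices : (N : ℕ) → List (Matrix m N)
  matrices N = allVecsOf (allVecs N) m

  act-cong : ∀ g {p q : Pol} → (∀ e → p e ≈ q e) → ∀ e → act g p e ≈ act g q e
  act-cong idP h e = h e
  act-cong (diagP q a) h e with xorSum (λ v → oddℕ (e v) ∧ (quadForm q v xor a)) (allVecs m)
  ... | true = -‿cong (h e)
  ... | false = h e
  act-cong (affP A b _) h e = h _
  act-cong (g ∘P g') h e = act-cong g (act-cong g' h) e

  hasExponent-cong : ∀ {N} (M : Matrix m N) e e' → (∀ v → e v ≡ e' v) → hasExponent M e ≡ hasExponent M e'
  hasExponent-cong M e e' h = bool-ext (λ t → hasExponent-complete M e' (λ v → trans (sym (h v)) (hasExponent-sound M e t v)))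
    (λ t → hasExponent-complete M e (λ v → trans (h v) (hasExponent-sound M e' t v)))

  μ-ext : ∀ {N} (C : Code N) → Extensional (μ C)
  μ-ext {N} C e e' h = reflexive (cong (ringℕ cring) (countB-cong (matrices N) (λ M → cong (spans M C ∧_) (hasExponent-cong M e e' h))))

  hasExponent-deg : ∀ {N} (M : Matrix m N) e → hasExponent M e ≡ true → deg e ≡ N
  hasExponent-deg M e t = trans (deg-cong e (exponent M) (hasExponent-sound M e t)) (deg-exponent M)

  μ-homogeneous : ∀ {N} (C : Code N) → HomogeneousOfDeg N (μ C)
  μ-homogeneous {N} C = μ-ext C , λ e ne → reflexive (cong (ringℕ cring) (countB-zero _ (matrices N) (λ {M} _ → noContribution M e ne)))
    where
    noContribution : ∀ M e → ¬ (deg e ≡ N) → spans M C ∧ hasExponent M e ≡ false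
    noContribution M e ne with hasExponent M e in t
    ... | true = ⊥-elim (ne (hasExponent-deg M e t))
    ... | false = BoolP.∧-zeroʳ _

  generators∈code : ∀ {N} (M : Matrix m N) (C : Code N) → spans M C ≡ true → ∀ i → C (generators M i) ≡ true
  generators∈code M C s i = trans (spans-sound M C s (generators M i)) (codeOf-complete M (generators M i) (InSpan-gen (generators M) i))

  signBit : Exp m → (Fin m → Fin m → Bool) → Bool → Bool
  signBit e q a = xorSum (λ v → oddℕ (e v) ∧ (quadForm q v xor a)) (allVecs m)

  signBit-exponent : ∀ {N} (M : Matrix m N) e → (∀ v → e v ≡ exponent M v) → ∀ q a
    → signBit e q a ≡ parity N (λ j → quadForm q (col M j) xor a)
  signBit-exponent M e h q a = trans (xorSum-cong (allVecs m) (λ v → cong (λ n → oddℕ n ∧ (quadForm q v xor a)) (h v)))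
    (oddExponent-parity M (λ v → quadForm q v xor a))


  μ-invariant : ∀ {N} (C : Code N) → SelfOrthogonal C → Invariant (μ C)
  μ-invariant {N} C so idP e = ≈-refl
  μ-invariant {N} C so (diagP q a) e with signBit e q a in sb
  ... | false = ≈-refl
  ... | true = subst (λ z → - z ≈ z) (sym (cong (ringℕ cring) count≡0)) -0#≈0#
    where
    noContribution : ∀ M → spans M C ∧ hasExponent M e ≡ false
    noContribution M with spans M C in s | hasExponent M e in t
    ... | false | _ = refl
    ... | true | false = refl
    ... | true | true = ⊥-elim (true≢false (trans (sym sb) (trans (signBit-exponent M e (hasExponent-sound M e t) q a)
           (orthogonal⇒parity-false M (λ i i' → so _ _ (generators∈code M C s i) (generators∈code M C s i')) q a))))
    count≡0 : countB (λ M → spans M C ∧ hasExponent M e) (matrices N) ≡ 0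
    count≡0 = countB-zero _ (matrices N) (λ {M} _ → noContribution M)
  μ-invariant {N} C so (affP A b (B , BA , AB)) e = reflexive (cong (ringℕ cring) (AffineInvariance.countB-affine-invariant A B b BA AB C e))
  μ-invariant {N} C so (g ∘P g') e = ≈-trans (act-cong g (μ-invariant C so g') e) (μ-invariant C so g e)

  μ-inSpace : ∀ {N} (C : Code N) → SelfOrthogonal C → InSpace N (μ C)
  μ-inSpace C so = μ-homogeneous C , μ-invariant C so

-- Column permutations

fromBool : Bool → ℕ
fromBool b = if b then 1 else 0

countFin-punchIn : ∀ n (i : Fin (suc n)) (f : Fin (suc n) → Bool)
  → countFin (suc n) f ≡ fromBool (f i) + countFin n (λ j → f (punchIn i j))
countFin-punchIn n zero f = refl
countFin-punchIn (suc n) (suc i) f = begin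
  fromBool (f zero) + countFin (suc n) (λ j → f (suc j)) ≡⟨ cong (fromBool (f zero) +_) (countFin-punchIn n i (λ j → f (suc j))) ⟩
  fromBool (f zero) + (fromBool (f (suc i)) + countFin n (λ j → f (suc (punchIn i j))))
    ≡⟨ sym (NatP.+-assoc (fromBool (f zero)) _ _) ⟩
  (fromBool (f zero) + fromBool (f (suc i))) + countFin n (λ j → f (suc (punchIn i j)))
    ≡⟨ cong (_+ countFin n (λ j → f (suc (punchIn i j)))) (NatP.+-comm (fromBool (f zero)) _) ⟩
  (fromBool (f (suc i)) + fromBool (f zero)) + countFin n (λ j → f (suc (punchIn i j)))
    ≡⟨ NatP.+-assoc (fromBool (f (suc i))) _ _ ⟩
  fromBool (f (suc i)) + (fromBool (f zero) + countFin n (λ j → f (suc (punchIn i j)))) ∎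

countFin-pos : ∀ n (f : Fin n → Bool) k → countFin n f ≡ suc k → ∃ λ i → f i ≡ true
countFin-pos zero f k ()
countFin-pos (suc n) f k e with f zero in fz
... | true = zero , fz
... | false with countFin-pos n (λ i → f (suc i)) k e
... | i , fi = suc i , fi

permutation-from-counts : ∀ {m} n (c c' : Fin n → Vec Bool m)
  → (∀ v → countFin n (λ j → eqV (c j) v) ≡ countFin n (λ j → eqV (c' j) v))
  → Σ (Permutation′ n) λ τ → ∀ j → c' j ≡ c (τ ⟨$⟩ʳ j)
permutation-from-counts zero c c' h = Perm.id , λ ()
permutation-from-counts {m} (suc n) c c' h = τ , pf
  where
  v = c' zero
  ex : ∃ λ i → eqV (c i) v ≡ true
  ex = countFin-pos (suc n) (λ j → eqV (c j) v) _ (trans (h v) (cong (λ b → fromBool b + countFin n (λ j → eqV (c' (suc j)) v)) (eqV-complete refl)))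
  i = proj₁ ex
  ci : c i ≡ v
  ci = eqV-sound (proj₂ ex)
  d d' : Fin n → Vec Bool m
  d j = c (punchIn i j)
  d' j = c' (suc j)
  hd : ∀ w → countFin n (λ j → eqV (d j) w) ≡ countFin n (λ j → eqV (d' j) w)
  hd w = NatP.+-cancelˡ-≡ (fromBool (eqV v w)) _ _ (begin
    fromBool (eqV v w) + countFin n (λ j → eqV (d j) w) ≡⟨ cong (λ z → fromBool (eqV z w) + countFin n (λ j → eqV (d j) w)) (sym ci) ⟩
    fromBool (eqV (c i) w) + countFin n (λ j → eqV (d j) w) ≡⟨ sym (countFin-punchIn n i (λ j → eqV (c j) w)) ⟩
    countFin (suc n) (λ j → eqV (c j) w) ≡⟨ h w ⟩
    fromBool (eqV v w) + countFin n (λ j → eqV (d' j) w) ∎)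
  π = proj₁ (permutation-from-counts n d d' hd)
  τ = insert zero i π
  pf : ∀ j → c' j ≡ c (τ ⟨$⟩ʳ j)
  pf zero = sym ci
  pf (suc k) = trans (proj₂ (permutation-from-counts n d d' hd) k) (cong c (sym (insert-punchIn zero i π k)))

lookup-permV : ∀ {N} (σ : Permutation′ N) (x : Vec Bool N) j → lookup (permV σ x) j ≡ lookup x (σ ⟨$⟩ʳ j)
lookup-permV σ x j = lookup∘tabulate _ j

permV-flip : ∀ {N} (σ : Permutation′ N) (x : Vec Bool N) → permV σ (permV (flip σ) x) ≡ x
permV-flip σ x = lookup-ext λ j → trans (lookup-permV σ (permV (flip σ) x) j) (trans (lookup-permV (flip σ) x _) (cong (lookup x) (inverseˡ σ)))

flip-permV : ∀ {N} (σ : Permutation′ N) (x : Vec Bool N) → permV (flip σ) (permV σ x) ≡ x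
flip-permV σ x = lookup-ext λ j → trans (lookup-permV (flip σ) (permV σ x) j) (trans (lookup-permV σ x _) (cong (lookup x) (inverseʳ σ)))

permV-injective : ∀ {N} (σ : Permutation′ N) {u v : Vec Bool N} → permV σ u ≡ permV σ v → u ≡ v
permV-injective σ {u} {v} e = trans (sym (flip-permV σ u)) (trans (cong (permV (flip σ)) e) (flip-permV σ v))

module ColumnPermutation {m N : ℕ} (M M' : Matrix m N) (τ : Permutation′ N) (hc : ∀ j → col M' j ≡ col M (τ ⟨$⟩ʳ j)) where
  generators-permV : ∀ i → generators M' i ≡ permV τ (generators M i)
  generators-permV zero = lookup-ext λ j → trans (lookup-onesV j) (sym (trans (lookup-permV τ onesV j) (lookup-onesV {N} _)))
  generators-permV (suc r) = lookup-ext λ j → trans (sym (lookup-col M' j r)) (trans (cong (λ z → lookup z r) (hc j))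
    (trans (lookup-col M _ r) (sym (lookup-permV τ (lookup M r) j))))

  linComb-permV : ∀ c → linComb (generators M') c ≡ permV τ (linComb (generators M) c)
  linComb-permV c = lookup-ext λ j → trans (lookup-linComb (generators M') c j) (trans (parity-cong (suc m) (λ i → cong (λ z → c i ∧ lookup z j) (generators-permV i)))
    (trans (parity-cong (suc m) (λ i → cong (c i ∧_) (lookup-permV τ (generators M i) j)))
    (sym (trans (lookup-permV τ (linComb (generators M) c) j) (lookup-linComb (generators M) c _)))))

  codeOf-permV : ∀ x → codeOf M x ≡ codeOf M' (permV τ x)
  codeOf-permV x = bool-ext
    (λ t → codeOf-complete M' _ (let (c , e) = codeOf-sound M x t in c , trans (linComb-permV c) (cong (permV τ) e)))
    (λ t → codeOf-complete M x (let (c , e) = codeOf-sound M' _ t in c , permV-injective τ (trans (sym (linComb-permV c)) e)))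

permuteColumns : ∀ {m N} → Permutation′ N → Matrix m N → Matrix m N
permuteColumns σ M = mapV (permV σ) M

col-permuteColumns : ∀ {m N} (σ : Permutation′ N) (M : Matrix m N) j → col (permuteColumns σ M) j ≡ col M (σ ⟨$⟩ʳ j)
col-permuteColumns σ M j = lookup-ext λ r → trans (lookup-col (permuteColumns σ M) j r) (trans (cong (λ z → lookup z j) (lookup-map r (permV σ) M))
  (trans (lookup-permV σ (lookup M r) j) (sym (lookup-col M _ r))))

exponent-permuteColumns : ∀ {m N} (σ : Permutation′ N) (M : Matrix m N) v → exponent (permuteColumns σ M) v ≡ exponent M v
exponent-permuteColumns {m} {N} σ M v = trans (countB-cong (allFinL N) (λ j → cong (λ z → eqV z v) (col-permuteColumns σ M j)))
  (countB-bijection (λ j → eqV (col M j) v) (allFin-enumeration N) (σ ⟨$⟩ʳ_) (σ ⟨$⟩ˡ_) (λ _ → inverseʳ σ) (λ _ → inverseˡ σ))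

sameExponent⇒Equivalent : ∀ {m N} (M M' : Matrix m N) (C C' : Code N) → spans M C ≡ true → spans M' C' ≡ true
  → (∀ v → exponent M v ≡ exponent M' v) → Equivalent C C'
sameExponent⇒Equivalent {m} {N} M M' C C' s s' h = τ , λ x → trans (spans-sound M C s x)
    (trans (ColumnPermutation.codeOf-permV M M' τ hc x) (sym (spans-sound M' C' s' _)))
  where
  hcount : ∀ v → countFin N (λ j → eqV (col M j) v) ≡ countFin N (λ j → eqV (col M' j) v)
  hcount v = trans (sym (countB-allFin N _)) (trans (h v) (countB-allFin N _))
  τ = proj₁ (permutation-from-counts N (col M) (col M') hcount)
  hc = proj₂ (permutation-from-counts N (col M) (col M') hcount)

Equivalent⇒spanningMatrix : ∀ {m N} (M : Matrix m N) (C : Code N) → Equivalent (codeOf M) C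
  → Σ (Matrix m N) λ M' → (spans M' C ≡ true) × (∀ v → exponent M' v ≡ exponent M v)
Equivalent⇒spanningMatrix {m} {N} M C (σ , hσ) = permuteColumns σ M , spans-complete (permuteColumns σ M) C sp , exponent-permuteColumns σ M
  where
  sp : ∀ y → C y ≡ codeOf (permuteColumns σ M) y
  sp y = begin
    C y ≡⟨ cong C (sym (permV-flip σ y)) ⟩
    C (permV σ (permV (flip σ) y)) ≡⟨ sym (hσ _) ⟩
    codeOf M (permV (flip σ) y) ≡⟨ ColumnPermutation.codeOf-permV M (permuteColumns σ M) σ (col-permuteColumns σ M) _ ⟩
    codeOf (permuteColumns σ M) (permV σ (permV (flip σ) y)) ≡⟨ cong (codeOf (permuteColumns σ M)) (permV-flip σ y) ⟩
    codeOf (permuteColumns σ M) y ∎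

-- Admissible codes and the matrices spanning them

search : ∀ n (f : Fin n → Bool) → (∃ λ i → f i ≡ true) ⊎ (∀ i → f i ≡ false)
search zero f = inj₂ (λ ())
search (suc n) f with f zero in e
... | true = inj₁ (zero , e)
... | false with search n (λ i → f (suc i))
... | inj₁ (i , p) = inj₁ (suc i , p)
... | inj₂ q = inj₂ (λ { zero → e ; (suc i) → q i })

inSpanᵇ : ∀ {k N} → Vec (Vec Bool N) k → Vec Bool N → Bool
inSpanᵇ {k} B x = anyL (λ λs → eqV (lincomb λs B) x) (allVecs k)

lincomb⇒InSpan : ∀ {k N} (B : Vec (Vec Bool N) k) {x} → (∃ λ λs → lincomb λs B ≡ x) → InSpan (lookup B) x
lincomb⇒InSpan B (λs , e) = lookup λs , trans (sym (lincomb≡linComb λs B)) e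

InSpan⇒lincomb : ∀ {k N} (B : Vec (Vec Bool N) k) {x} → InSpan (lookup B) x → ∃ λ λs → lincomb λs B ≡ x
InSpan⇒lincomb B (c , e) = tabulate c , trans (lincomb≡linComb (tabulate c) B) (trans (linComb-cong (lookup B) (lookup∘tabulate c)) e)

InSpan-lookup? : ∀ {k N} (B : Vec (Vec Bool N) k) x → Dec (InSpan (lookup B) x)
InSpan-lookup? {k} B x with inSpanᵇ B x in e
... | true = let (λs , _ , q) = anyL-sound _ (allVecs k) e in yes (lincomb⇒InSpan B (λs , eqV-sound q))
... | false = no λ p → let (λs , q) = InSpan⇒lincomb B p in
    true≢false (trans (sym (anyL-complete (λ λs → eqV (lincomb λs B) x) (allVecs k) (proj₂ (allVecs-enumeration k) λs) (eqV-complete q))) e)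

Independent : ∀ {k N} → Vec (Vec Bool N) k → Set
Independent {k} B = ∀ (λs : Vec Bool k) → lincomb λs B ≡ zeroV → λs ≡ replicate k false

addV≡zeroV⇒≡ : ∀ {N} (u w : Vec Bool N) → addV u w ≡ zeroV → u ≡ w
addV≡zeroV⇒≡ u w e = lookup-ext λ j → xorz (lookup u j) (lookup w j) (trans (sym (lookup-addV u w j)) (trans (cong (λ z → lookup z j) e) (lookup-zeroV j)))
  where
  xorz : ∀ a b → a xor b ≡ false → a ≡ b
  xorz false false _ = refl
  xorz true true _ = refl
  xorz false true ()
  xorz true false ()

InSpan-∷ : ∀ {k N} (x0 : Vec Bool N) (B : Vec (Vec Bool N) k) {y} → InSpan (lookup B) y → InSpan (lookup (x0 ∷ B)) y
InSpan-∷ x0 B (c , e) = (λ { zero → false ; (suc i) → c i }) , e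

extractBasis : ∀ {N} n (G : Fin n → Vec Bool N) → ∃ λ k → k ≤ n × Σ (Vec (Vec Bool N) k) λ B → Independent B
  × (∀ {x} → InSpan G x → InSpan (lookup B) x) × (∀ {x} → InSpan (lookup B) x → InSpan G x)
extractBasis zero G = 0 , z≤n , [] , (λ { [] _ → refl }) , (λ { (c , e) → (λ ()) , e }) , (λ { (c , e) → (λ ()) , e })
extractBasis (suc n) G with extractBasis n (λ i → G (suc i))
... | k' , le , B' , ind' , f' , g' with InSpan-lookup? B' (G zero)
... | yes p = k' , NatP.m≤n⇒m≤1+n le , B' , ind' ,
      InSpan-trans (lookup B') G (λ { zero → p ; (suc i) → f' (InSpan-gen (λ i → G (suc i)) i) }) ,
      (λ q → InSpan-trans G (λ i → G (suc i)) (λ i → InSpan-gen G (suc i)) (g' q))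
... | no ¬p = suc k' , s≤s le , G zero ∷ B' , indp ,
      InSpan-trans (lookup (G zero ∷ B')) G (λ { zero → InSpan-gen (lookup (G zero ∷ B')) zero
                                             ; (suc i) → InSpan-∷ (G zero) B' (f' (InSpan-gen (λ i → G (suc i)) i)) }) ,
      InSpan-trans G (lookup (G zero ∷ B')) (λ { zero → InSpan-gen G zero
                                             ; (suc i) → InSpan-trans G (λ i → G (suc i)) (λ i → InSpan-gen G (suc i)) (g' (InSpan-gen (lookup B') i)) })
  where
  indp : Independent (G zero ∷ B')
  indp (true ∷ λs) e = ⊥-elim (¬p (lincomb⇒InSpan B' (λs , sym (addV≡zeroV⇒≡ (G zero) _ e))))
  indp (false ∷ λs) e = cong (false ∷_) (ind' λs e)

∧-interchange : ∀ c a d b → (c ∧ a) ∧ (d ∧ b) ≡ (c ∧ d) ∧ (a ∧ b)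
∧-interchange false a d b = refl
∧-interchange true a false b = BoolP.∧-zeroʳ a
∧-interchange true a true b = refl

dot-linComb : ∀ {n N} (G : Fin n → Vec Bool N) c d
  → dot (linComb G c) (linComb G d) ≡ parity n (λ i → parity n (λ i' → (c i ∧ d i') ∧ dot (G i) (G i')))
dot-linComb {n} {N} G c d = begin
  dot (linComb G c) (linComb G d) ≡⟨ dot-parity (linComb G c) (linComb G d) ⟩
  parity N (λ j → lookup (linComb G c) j ∧ lookup (linComb G d) j) ≡⟨ parity-cong N (λ j → cong₂ _∧_ (lookup-linComb G c j) (lookup-linComb G d j)) ⟩
  parity N (λ j → parity n (λ i → c i ∧ lookup (G i) j) ∧ parity n (λ i' → d i' ∧ lookup (G i') j))
    ≡⟨ parity-cong N (λ j → trans (sym (parity-∧ʳ n _ _)) (parity-cong n (λ i → sym (parity-∧ˡ n _ _)))) ⟩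
  parity N (λ j → parity n (λ i → parity n (λ i' → (c i ∧ lookup (G i) j) ∧ (d i' ∧ lookup (G i') j))))
    ≡⟨ parity-cong N (λ j → parity-cong n (λ i → parity-cong n (λ i' → ∧-interchange (c i) _ (d i') _))) ⟩
  parity N (λ j → parity n (λ i → parity n (λ i' → (c i ∧ d i') ∧ (lookup (G i) j ∧ lookup (G i') j))))
    ≡⟨ parity-swap N n _ ⟩
  parity n (λ i → parity N (λ j → parity n (λ i' → (c i ∧ d i') ∧ (lookup (G i) j ∧ lookup (G i') j))))
    ≡⟨ parity-cong n (λ i → parity-swap N n _) ⟩
  parity n (λ i → parity n (λ i' → parity N (λ j → (c i ∧ d i') ∧ (lookup (G i) j ∧ lookup (G i') j))))
    ≡⟨ parity-cong n (λ i → parity-cong n (λ i' → trans (parity-∧ˡ N (c i ∧ d i') _) (cong ((c i ∧ d i') ∧_) (sym (dot-parity (G i) (G i')))))) ⟩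
  parity n (λ i → parity n (λ i' → (c i ∧ d i') ∧ dot (G i) (G i'))) ∎

codeOf-admissible : ∀ {m N} (M : Matrix m N) → GeneratorsOrthogonal M → Admissible m (codeOf M)
codeOf-admissible {m} {N} M h = lin , so , one , dim
  where
  G = generators M
  lin : IsLinearCode (codeOf M)
  lin = codeOf-complete M zeroV (InSpan-zeroV G) , λ x y px py → codeOf-complete M _ (InSpan-addV G (codeOf-sound M x px) (codeOf-sound M y py))
  so : SelfOrthogonal (codeOf M)
  so x y px py with codeOf-sound M x px | codeOf-sound M y py
  ... | c , refl | d , refl = trans (dot-linComb G c d) (parity-allFalse (suc m) (λ i → parity-allFalse (suc m) (λ i' →
          trans (cong ((c i ∧ d i') ∧_) (h i i')) (BoolP.∧-zeroʳ _))))
  one : ContainsOne (codeOf M)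
  one = codeOf-complete M onesV (InSpan-gen G zero)
  dim : ∃ λ k → k ≤ suc m × HasDim (codeOf M) k
  dim with extractBasis (suc m) G
  ... | k , le , B , indep , f , g = k , le , B , indep , λ x →
        (λ p → InSpan⇒lincomb B (f (codeOf-sound M x p))) , (λ q → codeOf-complete M x (g (lincomb⇒InSpan B q)))

orthogonal? : ∀ {m N} (M : Matrix m N)
  → GeneratorsOrthogonal M ⊎ (∃ λ i → ∃ λ i' → dot (generators M i) (generators M i') ≡ true)
orthogonal? {m} M with FinP.all? (λ i → FinP.all? (λ i' → dot (generators M i) (generators M i') BoolP.≟ false))
... | yes orth = inj₁ orth
... | no ¬orth with FinP.¬∀⟶∃¬ (suc m) _ (λ i → FinP.all? (λ i' → dot (generators M i) (generators M i') BoolP.≟ false)) ¬orth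
... | i , ¬row with FinP.¬∀⟶∃¬ (suc m) _ (λ i' → dot (generators M i) (generators M i') BoolP.≟ false) ¬row
... | i' , ¬o = inj₂ (i , i' , BoolP.¬-not ¬o)

parity-punchIn : ∀ n (i : Fin (suc n)) (f : Fin (suc n) → Bool) → parity (suc n) f ≡ f i xor parity n (λ j → f (punchIn i j))
parity-punchIn n zero f = refl
parity-punchIn (suc n) (suc i) f = begin
  f zero xor parity (suc n) (λ j → f (suc j)) ≡⟨ cong (f zero xor_) (parity-punchIn n i (λ j → f (suc j))) ⟩
  f zero xor (f (suc i) xor parity n (λ j → f (suc (punchIn i j)))) ≡⟨ sym (BoolP.xor-assoc (f zero) _ _) ⟩
  (f zero xor f (suc i)) xor parity n (λ j → f (suc (punchIn i j))) ≡⟨ cong (_xor parity n (λ j → f (suc (punchIn i j)))) (BoolP.xor-comm (f zero) _) ⟩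
  (f (suc i) xor f zero) xor parity n (λ j → f (suc (punchIn i j))) ≡⟨ BoolP.xor-assoc (f (suc i)) _ _ ⟩
  f (suc i) xor (f zero xor parity n (λ j → f (suc (punchIn i j)))) ∎

onesV-coefficient : ∀ {m N} (B : Vec (Vec Bool N) (suc m)) → Independent B
  → (a : Fin (suc m) → Bool) → linComb (lookup B) a ≡ onesV → ∃ λ i → a i ≡ true
onesV-coefficient {m} {N} B indep a ea with search (suc m) a
... | inj₁ found = found
... | inj₂ allFalse = ⊥-elim (contra N refl)
  where
  ones≡zero : onesV ≡ zeroV
  ones≡zero = trans (sym ea) (lookup-ext λ j → trans (lookup-linComb (lookup B) a j)
    (trans (parity-allFalse (suc m) (λ i → cong (_∧ lookup (lookup B i) j) (allFalse i))) (sym (lookup-zeroV j))))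
  contra : ∀ n → n ≡ N → ⊥
  contra zero refl = true≢false (cong V.head (indep (true ∷ replicate m false) (empty≡ _ _)))
    where
    empty≡ : ∀ (u v : Vec Bool 0) → u ≡ v
    empty≡ [] [] = refl
  contra (suc n) refl = true≢false (trans (sym (lookup-onesV {suc n} zero))
    (trans (cong (λ v → lookup v zero) ones≡zero) (lookup-zeroV {suc n} zero)))

spans-fromBasis : ∀ {m N k} (M : Matrix m N) (C : Code N) (B : Vec (Vec Bool N) k)
  → (∀ x → C x ≡ true → InSpan (lookup B) x) → (∀ x → InSpan (lookup B) x → C x ≡ true)
  → (∀ {x} → InSpan (generators M) x → InSpan (lookup B) x) → (∀ {x} → InSpan (lookup B) x → InSpan (generators M) x)
  → spans M C ≡ true
spans-fromBasis M C B c→ →c f g = spans-complete M C λ x → bool-ext (λ e → codeOf-complete M x (g (c→ x e))) (λ e → →c x (f (codeOf-sound M x e)))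

module _ {N : ℕ} (C : Code N) (one : ContainsOne C) where

  spanningMatrix-pad : ∀ {k} d (B : Vec (Vec Bool N) k)
    → (∀ x → C x ≡ true → InSpan (lookup B) x) → (∀ x → InSpan (lookup B) x → C x ≡ true)
    → ∃ λ (M : Matrix (k + d) N) → spans M C ≡ true
  spanningMatrix-pad {k} d B c→ →c = M , spans-fromBasis M C B c→ →c f g
    where
    M = B ++ᵛ replicate d zeroV
    elems : ∀ {k} (B : Vec (Vec Bool N) k) i → (∃ λ i' → lookup (B ++ᵛ replicate d zeroV) i ≡ lookup B i') ⊎ lookup (B ++ᵛ replicate d zeroV) i ≡ zeroV
    elems [] i = inj₂ (lookup-replicate i zeroV)
    elems (x ∷ B) zero = inj₁ (zero , refl)
    elems (x ∷ B) (suc i) with elems B i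
    ... | inj₁ (i' , e) = inj₁ (suc i' , e)
    ... | inj₂ e = inj₂ e
    inApp : ∀ {k} (B : Vec (Vec Bool N) k) i' → ∃ λ i → lookup (B ++ᵛ replicate d zeroV) i ≡ lookup B i'
    inApp (x ∷ B) zero = zero , refl
    inApp (x ∷ B) (suc i') = let (i , e) = inApp B i' in suc i , e
    f : ∀ {x} → InSpan (generators M) x → InSpan (lookup B) x
    f = InSpan-trans (lookup B) (generators M) λ { zero → c→ onesV one
      ; (suc i) → [ (λ { (i' , e) → subst (InSpan (lookup B)) (sym e) (InSpan-gen (lookup B) i') })
                  , (λ e → subst (InSpan (lookup B)) (sym e) (InSpan-zeroV (lookup B))) ]′ (elems B i) }
    g : ∀ {x} → InSpan (lookup B) x → InSpan (generators M) x
    g = InSpan-trans (generators M) (lookup B) λ i' → let (i , e) = inApp B i' in subst (InSpan (generators M)) e (InSpan-gen (generators M) (suc i))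

  spanningMatrix-drop : ∀ {m} (B : Vec (Vec Bool N) (suc m)) → Independent B
    → (∀ x → C x ≡ true → InSpan (lookup B) x) → (∀ x → InSpan (lookup B) x → C x ≡ true)
    → ∃ λ (M : Matrix m N) → spans M C ≡ true
  spanningMatrix-drop {m} B indep c→ →c with c→ onesV one
  ... | a , ea with onesV-coefficient B indep a ea
  ... | i , ai = M , spans-fromBasis M C B c→ →c f g
    where
    M : Matrix m N
    M = tabulate (λ j → lookup B (punchIn i j))
    f : ∀ {x} → InSpan (generators M) x → InSpan (lookup B) x
    f = InSpan-trans (lookup B) (generators M) λ { zero → c→ onesV one
      ; (suc j) → subst (InSpan (lookup B)) (sym (lookup∘tabulate (λ j → lookup B (punchIn i j)) j)) (InSpan-gen (lookup B) (punchIn i j)) }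
    c : Fin (suc m) → Bool
    c zero = true
    c (suc j) = a (punchIn i j)
    Bi : linComb (generators M) c ≡ lookup B i
    Bi = lookup-ext Bt
      where
      Bt : ∀ t → lookup (linComb (generators M) c) t ≡ lookup (lookup B i) t
      Bt t = begin
        lookup (linComb (generators M) c) t ≡⟨ lookup-linComb (generators M) c t ⟩
        (true ∧ lookup onesV t) xor parity m (λ j → a (punchIn i j) ∧ lookup (lookup M j) t)
          ≡⟨ cong₂ _xor_ (lookup-onesV t) (parity-cong m (λ j → cong (λ z → a (punchIn i j) ∧ lookup z t) (lookup∘tabulate (λ j → lookup B (punchIn i j)) j))) ⟩
        true xor X ≡⟨ cong (_xor X) (trans (sym (lookup-onesV t)) (trans (cong (λ z → lookup z t) (sym ea)) (lookup-linComb (lookup B) a t))) ⟩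
        parity (suc m) (λ r → a r ∧ lookup (lookup B r) t) xor X ≡⟨ cong (_xor X) (parity-punchIn m i (λ r → a r ∧ lookup (lookup B r) t)) ⟩
        ((a i ∧ lookup (lookup B i) t) xor X) xor X ≡⟨ BoolP.xor-assoc (a i ∧ lookup (lookup B i) t) X X ⟩
        (a i ∧ lookup (lookup B i) t) xor (X xor X) ≡⟨ cong₂ _xor_ (cong (_∧ _) ai) (BoolP.xor-same X) ⟩
        lookup (lookup B i) t xor false ≡⟨ BoolP.xor-identityʳ _ ⟩
        lookup (lookup B i) t ∎
        where
        X = parity m (λ j → a (punchIn i j) ∧ lookup (lookup B (punchIn i j)) t)
    g : ∀ {x} → InSpan (lookup B) x → InSpan (generators M) x
    g = InSpan-trans (generators M) (lookup B) λ r → h r (r F.≟ i)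
      where
      h : ∀ r → Dec (r ≡ i) → InSpan (generators M) (lookup B r)
      h r (yes refl) = c , Bi
      h r (no ne) = subst (λ z → InSpan (generators M) (lookup B z)) (FinP.punchIn-punchOut {i = i} {j = r} (λ e → ne (sym e)))
        (subst (InSpan (generators M)) (lookup∘tabulate (λ j → lookup B (punchIn i j)) _) (InSpan-gen (generators M) (suc (punchOut {i = i} {j = r} (λ e → ne (sym e))))))

  spanningMatrix : ∀ {m} → ∀ k → k ≤ suc m → HasDim C k → ∃ λ (M : Matrix m N) → spans M C ≡ true
  spanningMatrix {m} k le (B , indep , sp) with NatP.m≤n⇒m<n∨m≡n le
  ... | inj₂ refl = spanningMatrix-drop B indep c→ →c
    where
    c→ = λ x e → lincomb⇒InSpan B (proj₁ (sp x) e)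
    →c = λ x e → proj₂ (sp x) (InSpan⇒lincomb B e)
  ... | inj₁ (s≤s le') with NatP.m≤n⇒∃[o]m+o≡n le'
  ... | d , eq = subst (λ m' → ∃ λ (M : Matrix m' N) → spans M C ≡ true) eq (spanningMatrix-pad d B c→ →c)
    where
    c→ = λ x e → lincomb⇒InSpan B (proj₁ (sp x) e)
    →c = λ x e → proj₂ (sp x) (InSpan⇒lincomb B e)

-- Matrices with a prescribed exponent

sumStep-leftComm : ∀ {A : Set} (f : A → ℕ) → LeftCommutative (λ a s → f a + s)
sumStep-leftComm f a b s = trans (sym (NatP.+-assoc (f a) _ _)) (trans (cong (_+ s) (NatP.+-comm (f a) _)) (NatP.+-assoc (f b) _ _))

sumL-zero : ∀ {A : Set} (f : A → ℕ) (L : List A) → (∀ {a} → a ∈ L → f a ≡ 0) → sumL f L ≡ 0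
sumL-zero f [] h = refl
sumL-zero f (a ∷ L) h = cong₂ _+_ (h (here refl)) (sumL-zero f L (λ p → h (there p)))

sumL-single : ∀ {A : Set} {L : List A} → IsEnumeration L → (c : A) (f : A → ℕ) → (∀ a → a ≢ c → f a ≡ 0) → sumL f L ≡ f c
sumL-single {L = L} E c f h with ∈-∃++ (proj₂ E c)
... | as , bs , refl = trans (foldr-↭ (λ a s → f a + s) (sumStep-leftComm f) 0 (shift c as bs))
  (trans (cong (f c +_) (sumL-zero f (as ++ bs) (λ {a} p → h a (λ { refl → proj₂ (Unique-dropMiddle as (proj₁ E)) p }))))
    (NatP.+-identityʳ (f c)))

countVec : ∀ {A : Set} {n} → Vec A n → (A → Bool) → ℕ
countVec [] p = 0
countVec (x ∷ xs) p = fromBool (p x) + countVec xs p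

countVec-countFin : ∀ {A : Set} {n} (V : Vec A n) p → countVec V p ≡ countFin n (λ j → p (lookup V j))
countVec-countFin [] p = refl
countVec-countFin (x ∷ V) p = cong (fromBool (p x) +_) (countVec-countFin V p)

countVec-++ : ∀ {A : Set} {a b} (xs : Vec A a) (ys : Vec A b) p → countVec (xs ++ᵛ ys) p ≡ countVec xs p + countVec ys p
countVec-++ [] ys p = refl
countVec-++ (x ∷ xs) ys p = trans (cong (fromBool (p x) +_) (countVec-++ xs ys p)) (sym (NatP.+-assoc (fromBool (p x)) _ _))

countVec-replicate : ∀ {A : Set} k (v : A) p → countVec (replicate k v) p ≡ (if p v then k else 0)
countVec-replicate zero v p with p v
... | true = refl
... | false = refl
countVec-replicate (suc k) v p with p v in e
... | true = cong suc (trans (countVec-replicate k v p) (cong (λ b → if b then k else 0) e))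
... | false = trans (countVec-replicate k v p) (cong (λ b → if b then k else 0) e)

module MatrixWithExponent {m : ℕ} (e : Vec Bool m → ℕ) where
  columnsOf : (L : List (Vec Bool m)) → Vec (Vec Bool m) (sumL e L)
  columnsOf [] = []
  columnsOf (v ∷ L) = replicate (e v) v ++ᵛ columnsOf L

  countVec-columnsOf : ∀ L w → countVec (columnsOf L) (λ u → eqV u w) ≡ sumL (λ v → if eqV v w then e v else 0) L
  countVec-columnsOf [] w = refl
  countVec-columnsOf (v ∷ L) w = trans (countVec-++ (replicate (e v) v) (columnsOf L) _) (cong₂ _+_ (countVec-replicate (e v) v _) (countVec-columnsOf L w))

  fromColumns : ∀ {n} → Vec (Vec Bool m) n → Matrix m n
  fromColumns V = tabulate (λ i → tabulate (λ j → lookup (lookup V j) i))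

  col-fromColumns : ∀ {n} (V : Vec (Vec Bool m) n) j → col (fromColumns V) j ≡ lookup V j
  col-fromColumns V j = lookup-ext λ i → trans (lookup-col (fromColumns V) j i) (trans (cong (λ r → lookup r j) (lookup∘tabulate (λ i → tabulate (λ j → lookup (lookup V j) i)) i))
    (lookup∘tabulate (λ j → lookup (lookup V j) i) j))

  exponent-fromColumns : ∀ {n} (V : Vec (Vec Bool m) n) w → exponent (fromColumns V) w ≡ countVec V (λ u → eqV u w)
  exponent-fromColumns {n} V w = trans (countB-allFin n _) (trans (countFin-cong n (λ j → cong (λ z → eqV z w) (col-fromColumns V j))) (sym (countVec-countFin V _)))
    where
    countFin-cong : ∀ n {f g : Fin n → Bool} → (∀ i → f i ≡ g i) → countFin n f ≡ countFin n g
    countFin-cong zero h = refl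
    countFin-cong (suc n) h = cong₂ _+_ (cong fromBool (h zero)) (countFin-cong n (λ i → h (suc i)))

  matrix : Matrix m (deg e)
  matrix = fromColumns (columnsOf (allVecs m))

  matrix-exponent : ∀ w → e w ≡ exponent matrix w
  matrix-exponent w = sym (trans (exponent-fromColumns (columnsOf (allVecs m)) w) (trans (countVec-columnsOf (allVecs m) w)
    (trans (sumL-single (allVecs-enumeration m) w _ (λ v ne → cong (λ b → if b then e v else 0) (≢⇒eqV-false v w (λ q → ne (sym q)))))
      (cong (λ b → if b then e w else 0) (eqV-complete refl)))))

exponent⇒matrix : ∀ {m N} (e : Vec Bool m → ℕ) → deg e ≡ N → Σ (Matrix m N) λ M → ∀ v → e v ≡ exponent M v
exponent⇒matrix {m} e refl = MatrixWithExponent.matrix e , MatrixWithExponent.matrix-exponent e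

-- Row operations

≢⇒δ-false : ∀ {n} (i j : Fin n) → i ≢ j → δ i j ≡ false
≢⇒δ-false i j ne with δ i j in e
... | true = ⊥-elim (ne (δ⇒≡ i j e))
... | false = refl

linComb-termwise : ∀ {n N} (G G' : Fin n → Vec Bool N) c c'
  → (∀ i j → c i ∧ lookup (G i) j ≡ c' i ∧ lookup (G' i) j) → linComb G c ≡ linComb G' c'
linComb-termwise {n} G G' c c' h = tabulate-cong (λ j → parity-cong n (λ i → h i j))

dropCoeff : ∀ {n} → (Fin n → Bool) → Fin n → Fin n → Bool
dropCoeff a i k = a k ∧ not (δ k i)

linComb-split : ∀ {n N} (G : Fin n → Vec Bool N) a i → a i ≡ true → linComb G a ≡ addV (G i) (linComb G (dropCoeff a i))
linComb-split {n} G a i ai = lookup-ext λ j → begin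
  lookup (linComb G a) j ≡⟨ lookup-linComb G a j ⟩
  parity n (λ k → a k ∧ lookup (G k) j) ≡⟨ parity-cong n (λ k → term k j) ⟩
  parity n (λ k → (δ k i ∧ lookup (G k) j) xor (dropCoeff a i k ∧ lookup (G k) j)) ≡⟨ parity-xor n _ _ ⟩
  parity n (λ k → δ k i ∧ lookup (G k) j) xor parity n (λ k → dropCoeff a i k ∧ lookup (G k) j)
    ≡⟨ cong₂ _xor_ (parity-δ n i (λ k → lookup (G k) j)) (sym (lookup-linComb G (dropCoeff a i) j)) ⟩
  lookup (G i) j xor lookup (linComb G (dropCoeff a i)) j ≡⟨ sym (lookup-addV (G i) (linComb G (dropCoeff a i)) j) ⟩
  lookup (addV (G i) (linComb G (dropCoeff a i))) j ∎
  where
  term : ∀ k j → a k ∧ lookup (G k) j ≡ (δ k i ∧ lookup (G k) j) xor (dropCoeff a i k ∧ lookup (G k) j)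
  term k j with δ k i in e
  ... | true = trans (cong (λ z → a z ∧ lookup (G k) j) (δ⇒≡ k i e)) (trans (cong (_∧ _) ai)
         (sym (trans (cong (λ b → lookup (G k) j xor (b ∧ lookup (G k) j)) (BoolP.∧-zeroʳ (a k))) (BoolP.xor-identityʳ _))))
  ... | false = cong (λ b → b ∧ lookup (G k) j) (sym (BoolP.∧-identityʳ (a k)))

updateRow : ∀ {m N} → Matrix m N → Fin m → Vec Bool N → Matrix m N
updateRow X i r = tabulate (λ t → if δ t i then r else lookup X t)

lookup-updateRow-same : ∀ {m N} (X : Matrix m N) i r → lookup (updateRow X i r) i ≡ r
lookup-updateRow-same X i r = trans (lookup∘tabulate _ i) (cong (λ b → if b then r else lookup X i) (δ-refl i))

lookup-updateRow-other : ∀ {m N} (X : Matrix m N) i r t → t ≢ i → lookup (updateRow X i r) t ≡ lookup X t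
lookup-updateRow-other X i r t ne = trans (lookup∘tabulate _ t) (cong (λ b → if b then r else lookup X t) (≢⇒δ-false t i ne))

rowOp : ∀ {m N} → Matrix m N → Fin m → (Fin (suc m) → Bool) → Matrix m N
rowOp X i c = updateRow X i (addV (lookup X i) (linComb (generators X) c))

addV-self : ∀ {N} (u : Vec Bool N) → addV u u ≡ zeroV
addV-self u = lookup-ext λ j → trans (lookup-addV u u j) (trans (BoolP.xor-same (lookup u j)) (sym (lookup-zeroV j)))

rowOp-linComb : ∀ {m N} (X : Matrix m N) i c → c (suc i) ≡ false → linComb (generators (rowOp X i c)) c ≡ linComb (generators X) c
rowOp-linComb X i c ci = linComb-termwise (generators (rowOp X i c)) (generators X) c c h
  where
  h : ∀ k j → c k ∧ lookup (generators (rowOp X i c) k) j ≡ c k ∧ lookup (generators X k) j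
  h zero j = refl
  h (suc t) j with t F.≟ i
  ... | yes refl = trans (cong (_∧ lookup (generators (rowOp X i c) (suc t)) j) ci) (sym (cong (_∧ lookup (generators X (suc t)) j) ci))
  ... | no ne = cong (λ z → c (suc t) ∧ lookup z j) (lookup-updateRow-other X i _ t ne)

rowOp-codeOf : ∀ {m N} (X : Matrix m N) i c → c (suc i) ≡ false → ∀ x → codeOf (rowOp X i c) x ≡ codeOf X x
rowOp-codeOf {m} X i c ci = codeOf-cong (rowOp X i c) X (InSpan-trans (generators X) (generators (rowOp X i c)) f) (InSpan-trans (generators (rowOp X i c)) (generators X) g)
  where
  Y = rowOp X i c
  f : ∀ k → InSpan (generators X) (generators Y k)
  f zero = InSpan-gen (generators X) zero
  f (suc t) with t F.≟ i
  ... | yes refl = subst (InSpan (generators X)) (sym (lookup-updateRow-same X t _)) (InSpan-addV (generators X) (InSpan-gen (generators X) (suc t)) (c , refl))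
  ... | no ne = subst (InSpan (generators X)) (sym (lookup-updateRow-other X i _ t ne)) (InSpan-gen (generators X) (suc t))
  g : ∀ k → InSpan (generators Y) (generators X k)
  g zero = InSpan-gen (generators Y) zero
  g (suc t) with t F.≟ i
  ... | yes refl = subst (InSpan (generators Y)) eq (InSpan-addV (generators Y) (InSpan-gen (generators Y) (suc t)) (c , rowOp-linComb X t c ci))
    where
    eq : addV (lookup Y t) (linComb (generators X) c) ≡ lookup X t
    eq = trans (cong (λ z → addV z (linComb (generators X) c)) (lookup-updateRow-same X t _)) (addV-cancelʳ (lookup X t) _)
  ... | no ne = subst (InSpan (generators Y)) (lookup-updateRow-other X i _ t ne) (InSpan-gen (generators Y) (suc t))


<ᵇ⇒< : ∀ a b → (a <ᵇ b) ≡ true → a < b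
<ᵇ⇒< a b e = NatP.<ᵇ⇒< a b (≡true⇒T e)

<⇒<ᵇ : ∀ {a b} → a < b → (a <ᵇ b) ≡ true
<⇒<ᵇ p = T⇒≡true (NatP.<⇒<ᵇ p)

<ᵇ-irrefl : ∀ a → (a <ᵇ a) ≡ false
<ᵇ-irrefl a with (a <ᵇ a) in e
... | true = ⊥-elim (NatP.<-irrefl refl (<ᵇ⇒< a a e))
... | false = refl

InSpan-cong : ∀ {n N} (G G' : Fin n → Vec Bool N) → (∀ i → G i ≡ G' i) → ∀ {y} → InSpan G y → InSpan G' y
InSpan-cong G G' h (c , e) = c , trans (linComb-termwise G' G c c (λ i j → cong (λ z → c i ∧ lookup z j) (sym (h i)))) e

InSpan? : ∀ {n N} (G : Fin n → Vec Bool N) y → Dec (InSpan G y)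
InSpan? G y with InSpan-lookup? (tabulate G) y
... | yes p = yes (InSpan-cong _ G (lookup∘tabulate G) p)
... | no ¬p = no (λ q → ¬p (InSpan-cong G _ (λ i → sym (lookup∘tabulate G i)) q))

∧-xor-distrib : ∀ x y u v → (x xor y) ∧ (u xor v) ≡ ((x ∧ u) xor (x ∧ v)) xor ((y ∧ u) xor (y ∧ v))
∧-xor-distrib x y u v = trans (BoolP.∧-distribʳ-xor (u xor v) x y) (cong₂ _xor_ (BoolP.∧-distribˡ-xor x u v) (BoolP.∧-distribˡ-xor y u v))

∧-swapˡ : ∀ x e h → x ∧ (e ∧ h) ≡ e ∧ (x ∧ h)
∧-swapˡ false false h = refl
∧-swapˡ false true h = refl
∧-swapˡ true e h = refl

xor-cancel : ∀ s b → (s xor b) xor (b xor false) ≡ s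
xor-cancel s false = trans (BoolP.xor-identityʳ _) (BoolP.xor-identityʳ s)
xor-cancel s true = trans (cong (_xor true) (BoolP.xor-comm s true)) (trans (BoolP.xor-comm (not s) true) (BoolP.not-involutive s))

linComb-shear : ∀ {n N} (G G' : Fin n → Vec Bool N) (is ir : Fin n) → is ≢ ir
  → (∀ k j → lookup (G' k) j ≡ lookup (G k) j xor (δ k is ∧ lookup (G ir) j))
  → ∀ a → linComb G' (λ k → a k xor (δ k ir ∧ a is)) ≡ linComb G a
linComb-shear {n} G G' is ir ne hG a = lookup-ext pt
  where
  pt : ∀ j → lookup (linComb G' (λ k → a k xor (δ k ir ∧ a is))) j ≡ lookup (linComb G a) j
  pt j = begin
    lookup (linComb G' a') j ≡⟨ lookup-linComb G' a' j ⟩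
    parity n (λ k → a' k ∧ lookup (G' k) j) ≡⟨ parity-cong n (λ k → cong (a' k ∧_) (hG k j)) ⟩
    parity n (λ k → (a k xor (δ k ir ∧ A)) ∧ (g k xor (δ k is ∧ h))) ≡⟨ parity-cong n (λ k → ∧-xor-distrib (a k) _ (g k) _) ⟩
    parity n (λ k → ((a k ∧ g k) xor (a k ∧ (δ k is ∧ h))) xor (((δ k ir ∧ A) ∧ g k) xor ((δ k ir ∧ A) ∧ (δ k is ∧ h))))
      ≡⟨ trans (parity-xor n _ _) (cong₂ _xor_ (parity-xor n _ _) (parity-xor n _ _)) ⟩
    (S1 xor parity n (λ k → a k ∧ (δ k is ∧ h))) xor (parity n (λ k → (δ k ir ∧ A) ∧ g k) xor parity n (λ k → (δ k ir ∧ A) ∧ (δ k is ∧ h)))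
      ≡⟨ cong₂ (λ u v → (S1 xor u) xor v) s2 (cong₂ _xor_ s3 s4) ⟩
    (S1 xor (A ∧ h)) xor ((A ∧ h) xor false) ≡⟨ xor-cancel S1 (A ∧ h) ⟩
    S1 ≡⟨ sym (lookup-linComb G a j) ⟩
    lookup (linComb G a) j ∎
    where
    a' = λ k → a k xor (δ k ir ∧ a is)
    A = a is
    g = λ k → lookup (G k) j
    h = lookup (G ir) j
    S1 = parity n (λ k → a k ∧ g k)
    s2 : parity n (λ k → a k ∧ (δ k is ∧ h)) ≡ A ∧ h
    s2 = trans (parity-cong n (λ k → ∧-swapˡ (a k) (δ k is) h)) (parity-δ n is (λ k → a k ∧ h))
    s3 : parity n (λ k → (δ k ir ∧ A) ∧ g k) ≡ A ∧ h
    s3 = trans (parity-cong n (λ k → BoolP.∧-assoc (δ k ir) A (g k))) (parity-δ n ir (λ k → A ∧ g k))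
    s4 : parity n (λ k → (δ k ir ∧ A) ∧ (δ k is ∧ h)) ≡ false
    s4 = trans (parity-cong n (λ k → BoolP.∧-assoc (δ k ir) A _)) (trans (parity-δ n ir (λ k → A ∧ (δ k is ∧ h)))
      (trans (cong (λ b → A ∧ (b ∧ h)) (≢⇒δ-false ir is (λ e → ne (sym e)))) (BoolP.∧-zeroʳ A)))

-- A relation closed under row operations relates any two matrices spanning the
-- same code.  The target Y is first normalised so that each row is zero or
-- outside the span of 1 and the earlier rows.  Then the rows of X are replaced
-- one by one by the nonzero rows of Y: row t of Y lies in the common code, and
-- by normality any expression of it uses some row of X that is not yet fixed,
-- which can be moved to position t by a row operation and then rewritten.
-- Finally the rows where Y vanishes are cleared.
module RowReduction {ℓ : Level} {m N : ℕ} (R : Matrix m N → Matrix m N → Set ℓ)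
  (Rrefl : ∀ {X} → R X X) (Rsym : ∀ {X Y} → R X Y → R Y X) (Rtrans : ∀ {X Y Z} → R X Y → R Y Z → R X Z)
  (Rop : ∀ X i c → c (suc i) ≡ false → R X (rowOp X i c)) where

  belowᵇ : ℕ → Fin (suc m) → Bool
  belowᵇ t zero = true
  belowᵇ t (suc r) = toℕ r <ᵇ t

  InSpanBelow : Matrix m N → ℕ → Vec Bool N → Set
  InSpanBelow X t y = ∃ λ c → (∀ i → c i ≡ true → belowᵇ t i ≡ true) × linComb (generators X) c ≡ y

  generatorsBelow : Matrix m N → ℕ → Fin (suc m) → Vec Bool N
  generatorsBelow X t i = if belowᵇ t i then generators X i else zeroV

  InSpanBelow? : ∀ X t y → Dec (InSpanBelow X t y)
  InSpanBelow? X t y with InSpan? (generatorsBelow X t) y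
  ... | yes (c , e) = yes ((λ i → c i ∧ belowᵇ t i) , (λ i q → BoolP.∧-conicalʳ (c i) _ q) ,
          trans (linComb-termwise (generators X) (generatorsBelow X t) _ c h) e)
    where
    h : ∀ i j → (c i ∧ belowᵇ t i) ∧ lookup (generators X i) j ≡ c i ∧ lookup (generatorsBelow X t i) j
    h i j with belowᵇ t i
    ... | true = cong (_∧ _) (BoolP.∧-identityʳ (c i))
    ... | false = trans (cong (_∧ lookup (generators X i) j) (BoolP.∧-zeroʳ (c i))) (sym (trans (cong (c i ∧_) (lookup-zeroV j)) (BoolP.∧-zeroʳ (c i))))
  ... | no ¬p = no λ { (c , b , e) → ¬p (c , trans (linComb-termwise (generatorsBelow X t) (generators X) c c (h c b)) e) }
    where
    h : ∀ (c : Fin (suc m) → Bool) → (∀ i → c i ≡ true → belowᵇ t i ≡ true) → ∀ i j → c i ∧ lookup (generatorsBelow X t i) j ≡ c i ∧ lookup (generators X i) j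
    h c b i j with c i in ci
    ... | false = refl
    ... | true = cong (λ z → lookup (if z then generators X i else zeroV) j) (b i ci)

  AgreeBelow : Matrix m N → Matrix m N → ℕ → Set
  AgreeBelow X X' t = ∀ r → toℕ r < t → lookup X r ≡ lookup X' r

  InSpanBelow-transfer : ∀ X X' t → AgreeBelow X X' t → ∀ {y} → InSpanBelow X t y → InSpanBelow X' t y
  InSpanBelow-transfer X X' t ag (c , b , e) = c , b , trans (linComb-termwise (generators X') (generators X) c c h) e
    where
    h : ∀ i j → c i ∧ lookup (generators X' i) j ≡ c i ∧ lookup (generators X i) j
    h zero j = refl
    h (suc r) j with c (suc r) in cr
    ... | false = refl
    ... | true = cong (λ z → lookup z j) (sym (ag r (<ᵇ⇒< _ _ (b (suc r) cr))))

  Reduced : Matrix m N → Fin m → Set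
  Reduced Y r = lookup Y r ≡ zeroV ⊎ ¬ InSpanBelow Y (toℕ r) (lookup Y r)

  Reduced-transfer : ∀ Y Y' r → AgreeBelow Y Y' (suc (toℕ r)) → Reduced Y r → Reduced Y' r
  Reduced-transfer Y Y' r ag (inj₁ z) = inj₁ (trans (sym (ag r NatP.≤-refl)) z)
  Reduced-transfer Y Y' r ag (inj₂ ¬p) = inj₂ λ q → ¬p (subst (InSpanBelow Y (toℕ r)) (sym (ag r NatP.≤-refl))
    (InSpanBelow-transfer Y' Y (toℕ r) (λ r' lt → sym (ag r' (NatP.m≤n⇒m≤1+n lt))) q))

  lookup-rowOp-other : ∀ (X : Matrix m N) i c r → r ≢ i → lookup (rowOp X i c) r ≡ lookup X r
  lookup-rowOp-other X i c r ne = lookup-updateRow-other X i _ r ne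

  rowAt : ∀ {t} → t < m → Fin m
  rowAt lt = F.fromℕ< lt

  toℕ-rowAt : ∀ {t} (lt : t < m) → toℕ (rowAt lt) ≡ t
  toℕ-rowAt lt = FinP.toℕ-fromℕ< lt

  split< : ∀ {t} (lt : t < m) r → toℕ r < suc t → r ≡ rowAt lt ⊎ toℕ r < t
  split< {t} lt r le with r F.≟ rowAt lt
  ... | yes e = inj₁ e
  ... | no ne with NatP.m≤n⇒m<n∨m≡n (NatP.≤-pred le)
  ... | inj₁ l = inj₂ l
  ... | inj₂ e = ⊥-elim (ne (FinP.toℕ-injective (trans e (sym (toℕ-rowAt lt)))))

  <⇒≢rowAt : ∀ {t} (lt : t < m) r → toℕ r < t → r ≢ rowAt lt
  <⇒≢rowAt lt r l refl = NatP.<-irrefl (toℕ-rowAt lt) l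

  SameCode : Matrix m N → Matrix m N → Set
  SameCode X Y = ∀ x → codeOf X x ≡ codeOf Y x

  normalise : ∀ t → t ≤ m → ∀ Y → ∃ λ Y' → R Y Y' × SameCode Y' Y × (∀ r → toℕ r < t → Reduced Y' r)
  normalise zero _ Y = Y , Rrefl , (λ x → refl) , λ r ()
  normalise (suc t) le Y with normalise t (NatP.<⇒≤ le) Y
  ... | Y1 , R1 , S1 , N1 with InSpanBelow? Y1 t (lookup Y1 (rowAt le))
  ... | yes (c , b , e) = Y2 , Rtrans R1 (Rop Y1 r0 c cr0) , (λ x → trans (rowOp-codeOf Y1 r0 c cr0 x) (S1 x)) , nf
    where
    r0 = rowAt le
    cr0 : c (suc r0) ≡ false
    cr0 = BoolP.¬-not λ q → true≢false (trans (sym (b (suc r0) q)) (trans (cong (_<ᵇ t) (toℕ-rowAt le)) (<ᵇ-irrefl t)))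
    Y2 = rowOp Y1 r0 c
    agree : ∀ r → r ≢ r0 → lookup Y1 r ≡ lookup Y2 r
    agree r ne = sym (lookup-rowOp-other Y1 r0 c r ne)
    nf : ∀ r → toℕ r < suc t → Reduced Y2 r
    nf r l with split< le r l
    ... | inj₁ refl = inj₁ (trans (lookup-updateRow-same Y1 r _) (trans (cong (addV (lookup Y1 r)) e) (addV-self (lookup Y1 r))))
    ... | inj₂ l' = Reduced-transfer Y1 Y2 r (λ r' l'' → agree r' (<⇒≢rowAt le r' (NatP.<-≤-trans l'' l'))) (N1 r l')
  ... | no ¬p = Y1 , R1 , S1 , nf
    where
    r0 = rowAt le
    nf : ∀ r → toℕ r < suc t → Reduced Y1 r
    nf r l with split< le r l
    ... | inj₁ refl = inj₂ (subst (λ z → ¬ InSpanBelow Y1 z (lookup Y1 r)) (sym (toℕ-rowAt le)) ¬p)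
    ... | inj₂ l' = N1 r l'

  module Exchange (Y : Matrix m N) (NF : ∀ r → Reduced Y r) (X0 : Matrix m N) (S0 : SameCode X0 Y) where
    nonzeroᵇ : Fin m → Bool
    nonzeroᵇ r = not (eqV (lookup Y r) zeroV)

    nonzeroᵇ-true : ∀ r → nonzeroᵇ r ≡ true → lookup Y r ≡ zeroV → ⊥
    nonzeroᵇ-true r e z = true≢false (trans (sym e) (cong not (eqV-complete z)))

    nonzeroᵇ-false : ∀ r → nonzeroᵇ r ≡ false → lookup Y r ≡ zeroV
    nonzeroᵇ-false r e with eqV (lookup Y r) zeroV in q
    ... | true = eqV-sound q

    fixedᵇ : ℕ → Fin (suc m) → Bool
    fixedᵇ t zero = true
    fixedᵇ t (suc r) = (toℕ r <ᵇ t) ∧ nonzeroᵇ r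

    Fixed : ℕ → Matrix m N → Set
    Fixed t X = ∀ r → fixedᵇ t (suc r) ≡ true → lookup X r ≡ lookup Y r

    ExchangeState : ℕ → Set ℓ
    ExchangeState t = Σ (Matrix m N) λ X → R X0 X × SameCode X Y × Fixed t X

    classify : ∀ {t} (lt : t < m) r → fixedᵇ (suc t) (suc r) ≡ true → (r ≡ rowAt lt × nonzeroᵇ r ≡ true) ⊎ fixedᵇ t (suc r) ≡ true
    classify {t} lt r e with split< lt r (<ᵇ⇒< _ _ (BoolP.∧-conicalˡ _ _ e))
    ... | inj₁ eq = inj₁ (eq , BoolP.∧-conicalʳ (toℕ r <ᵇ suc t) _ e)
    ... | inj₂ l = inj₂ (true-∧ (<⇒<ᵇ l) (BoolP.∧-conicalʳ (toℕ r <ᵇ suc t) _ e))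

    rowAt-unfixed : ∀ {t} (lt : t < m) → fixedᵇ t (suc (rowAt lt)) ≡ false
    rowAt-unfixed {t} lt = trans (cong (λ z → (z <ᵇ t) ∧ nonzeroᵇ (rowAt lt)) (toℕ-rowAt lt)) (cong (_∧ nonzeroᵇ (rowAt lt)) (<ᵇ-irrefl t))

    exchangeRow : ∀ {t} (lt : t < m) → (st : ExchangeState t) → (a : Fin (suc m) → Bool) → a (suc (rowAt lt)) ≡ true
      → linComb (generators (proj₁ st)) a ≡ lookup Y (rowAt lt) → ExchangeState (suc t)
    exchangeRow {t} lt (X , RX , SX , IX) a ar ea = X2 , Rtrans RX (Rop X r0 c cr) , (λ x → trans (rowOp-codeOf X r0 c cr x) (SX x)) , inv
      where
      r0 = rowAt lt
      c = dropCoeff a (suc r0)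
      cr : c (suc r0) ≡ false
      cr = trans (cong (λ b → a (suc r0) ∧ not b) (δ-refl r0)) (BoolP.∧-zeroʳ _)
      X2 = rowOp X r0 c
      inv : Fixed (suc t) X2
      inv r e with classify lt r e
      ... | inj₁ (refl , _) = trans (lookup-updateRow-same X r _) (trans (sym (linComb-split (generators X) a (suc r) ar)) ea)
      ... | inj₂ f = trans (lookup-rowOp-other X r0 c r (λ { refl → true≢false (trans (sym f) (rowAt-unfixed lt)) })) (IX r f)

    unfixedRow-used : ∀ {t} (lt : t < m) (st : ExchangeState t) → nonzeroᵇ (rowAt lt) ≡ true
      → (a : Fin (suc m) → Bool) → linComb (generators (proj₁ st)) a ≡ lookup Y (rowAt lt)
      → ∃ λ s → a (suc s) ∧ not (fixedᵇ t (suc s)) ≡ true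
    unfixedRow-used {t} lt (X , _ , _ , IX) nzr a ea with search m (λ s → a (suc s) ∧ not (fixedᵇ t (suc s)))
    ... | inj₁ found = found
    ... | inj₂ none = ⊥-elim (contra (NF r0))
      where
      r0 = rowAt lt
      bel : ∀ i → a i ≡ true → belowᵇ (toℕ r0) i ≡ true
      bel zero _ = refl
      bel (suc s) q = subst (λ z → (toℕ s <ᵇ z) ≡ true) (sym (toℕ-rowAt lt))
        (BoolP.∧-conicalˡ _ _ (fixed s q))
        where
        fixed : ∀ s → a (suc s) ≡ true → fixedᵇ t (suc s) ≡ true
        fixed s q with fixedᵇ t (suc s) in fq
        ... | true = refl
        ... | false = ⊥-elim (true≢false (trans (sym (cong (_∧ not false) q)) (trans refl (trans (cong (λ b → a (suc s) ∧ not b) (sym fq)) (none s)))))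
      lcY : linComb (generators Y) a ≡ linComb (generators X) a
      lcY = linComb-termwise (generators Y) (generators X) a a h
        where
        h : ∀ i j → a i ∧ lookup (generators Y i) j ≡ a i ∧ lookup (generators X i) j
        h zero j = refl
        h (suc s) j with a (suc s) in q
        ... | false = refl
        ... | true with fixedᵇ t (suc s) in fq
        ... | true = cong (λ z → lookup z j) (sym (IX s fq))
        ... | false = ⊥-elim (true≢false (trans (sym (cong (_∧ not false) q)) (trans (cong (λ b → a (suc s) ∧ not b) (sym fq)) (none s))))
      contra : Reduced Y r0 → ⊥
      contra (inj₁ z) = nonzeroᵇ-true r0 nzr z
      contra (inj₂ ¬p) = ¬p (a , bel , trans lcY ea)

    exchangeVia : ∀ {t} (lt : t < m) (st : ExchangeState t) (a : Fin (suc m) → Bool) → a (suc (rowAt lt)) ≡ false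
      → linComb (generators (proj₁ st)) a ≡ lookup Y (rowAt lt)
      → ∀ s → a (suc s) ∧ not (fixedᵇ t (suc s)) ≡ true → ExchangeState (suc t)
    exchangeVia {t} lt (X , RX , SX , IX) a ar ea s hs =
      exchangeRow lt (X' , Rtrans RX (Rop X s c1 c1s) , (λ x → trans (rowOp-codeOf X s c1 c1s x) (SX x)) , invX') a' a'r0 lc'
      where
      r0 = rowAt lt
      as : a (suc s) ≡ true
      as = BoolP.∧-conicalˡ _ _ hs
      fs : fixedᵇ t (suc s) ≡ false
      fs = BoolP.not-injective (BoolP.∧-conicalʳ (a (suc s)) _ hs)
      s≢r0 : s ≢ r0
      s≢r0 refl = true≢false (trans (sym as) ar)
      c1 : Fin (suc m) → Bool
      c1 k = δ k (suc r0)
      c1s : c1 (suc s) ≡ false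
      c1s = ≢⇒δ-false s r0 s≢r0
      X' = rowOp X s c1
      invX' : Fixed t X'
      invX' r f = trans (lookup-rowOp-other X s c1 r (λ { refl → true≢false (trans (sym f) fs) })) (IX r f)
      a' : Fin (suc m) → Bool
      a' k = a k xor (δ k (suc r0) ∧ a (suc s))
      a'r0 : a' (suc r0) ≡ true
      a'r0 = trans (cong₂ (λ u v → u xor (v ∧ a (suc s))) ar (δ-refl r0)) as
      hG : ∀ k j → lookup (generators X' k) j ≡ lookup (generators X k) j xor (δ k (suc s) ∧ lookup (generators X (suc r0)) j)
      hG zero j = sym (BoolP.xor-identityʳ _)
      hG (suc r) j with r F.≟ s
      ... | yes refl = trans (cong (λ z → lookup z j) (lookup-updateRow-same X r _))
           (trans (lookup-addV (lookup X r) _ j) (cong (lookup (lookup X r) j xor_)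
             (trans (cong (λ z → lookup z j) (proj₂ (InSpan-gen (generators X) (suc r0))))
               (sym (cong (_∧ lookup (lookup X r0) j) (δ-refl r)))))) 
      ... | no ne = trans (cong (λ z → lookup z j) (lookup-rowOp-other X s c1 r ne))
           (sym (trans (cong (λ b → lookup (lookup X r) j xor (b ∧ lookup (lookup X r0) j)) (≢⇒δ-false r s ne)) (BoolP.xor-identityʳ _)))
      lc' : linComb (generators X') a' ≡ lookup Y r0
      lc' = trans (linComb-shear (generators X) (generators X') (suc s) (suc r0) (λ e → s≢r0 (FinP.suc-injective e)) hG a) ea

    exchangeStep : ∀ {t} (lt : t < m) → ExchangeState t → ExchangeState (suc t)
    exchangeStep {t} lt (X , RX , SX , IX) with nonzeroᵇ (rowAt lt) in nzr
    ... | false = X , RX , SX , inv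
      where
      inv : Fixed (suc t) X
      inv r e with classify lt r e
      ... | inj₁ (refl , q) = ⊥-elim (true≢false (trans (sym q) nzr))
      ... | inj₂ f = IX r f
    ... | true with codeOf-sound X (lookup Y (rowAt lt)) (trans (SX _) (codeOf-complete Y _ (InSpan-gen (generators Y) (suc (rowAt lt)))))
    ... | a , ea with a (suc (rowAt lt)) in ar
    ... | true = exchangeRow lt (X , RX , SX , IX) a ar ea
    ... | false with unfixedRow-used lt (X , RX , SX , IX) nzr a ea
    ... | s , hs = exchangeVia lt (X , RX , SX , IX) a ar ea s hs

    exchangeUpTo : ∀ t → t ≤ m → ExchangeState t
    exchangeUpTo zero _ = X0 , Rrefl , S0 , λ r e → ⊥-elim (true≢false (trans (sym e) refl))
    exchangeUpTo (suc t) le = exchangeStep le (exchangeUpTo t (NatP.<⇒≤ le))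

    ZeroingState : ℕ → Set ℓ
    ZeroingState t = Σ (Matrix m N) λ X → R X0 X × SameCode X Y × (∀ r → (nonzeroᵇ r ≡ true ⊎ toℕ r < t) → lookup X r ≡ lookup Y r)

    nonzero⇒fixed : ∀ r → nonzeroᵇ r ≡ true → fixedᵇ m (suc r) ≡ true
    nonzero⇒fixed r e = true-∧ (<⇒<ᵇ (FinP.toℕ<n r)) e

    clearRow : ∀ {t} (le : t < m) → ZeroingState t → nonzeroᵇ (rowAt le) ≡ false → ZeroingState (suc t)
    clearRow {t} le (X , RX , SX , IX) nzr with codeOf-sound Y (lookup X (rowAt le)) (trans (sym (SX _)) (codeOf-complete X _ (InSpan-gen (generators X) (suc (rowAt le)))))
    ... | b , eb = X2 , Rtrans RX (Rop X r0 c cr) , (λ x → trans (rowOp-codeOf X r0 c cr x) (SX x)) , inv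
      where
      r0 = rowAt le
      fa : Fin (suc m) → Bool
      fa zero = true
      fa (suc r) = nonzeroᵇ r
      c : Fin (suc m) → Bool
      c i = b i ∧ fa i
      cr : c (suc r0) ≡ false
      cr = trans (cong (b (suc r0) ∧_) nzr) (BoolP.∧-zeroʳ _)
      lc : linComb (generators X) c ≡ lookup X r0
      lc = trans (linComb-termwise (generators X) (generators Y) c b h) eb
        where
        h : ∀ i j → c i ∧ lookup (generators X i) j ≡ b i ∧ lookup (generators Y i) j
        h zero j = cong (_∧ _) (BoolP.∧-identityʳ (b zero))
        h (suc r) j with nonzeroᵇ r in q
        ... | true = trans (cong (_∧ lookup (lookup X r) j) (BoolP.∧-identityʳ (b (suc r)))) (cong (λ z → b (suc r) ∧ lookup z j) (IX r (inj₁ q)))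
        ... | false = trans (cong (_∧ lookup (lookup X r) j) (BoolP.∧-zeroʳ (b (suc r))))
                (sym (trans (cong (λ z → b (suc r) ∧ lookup z j) (nonzeroᵇ-false r q)) (trans (cong (b (suc r) ∧_) (lookup-zeroV j)) (BoolP.∧-zeroʳ _))))
      X2 = rowOp X r0 c
      inv : ∀ r → (nonzeroᵇ r ≡ true ⊎ toℕ r < suc t) → lookup X2 r ≡ lookup Y r
      inv r h with r F.≟ r0
      ... | yes refl = trans (lookup-updateRow-same X r _) (trans (cong (addV (lookup X r)) lc) (trans (addV-self (lookup X r)) (sym (nonzeroᵇ-false r nzr))))
      ... | no ne = trans (lookup-rowOp-other X r0 c r ne) (IX r (h' h))
        where
        h' : (nonzeroᵇ r ≡ true ⊎ toℕ r < suc t) → (nonzeroᵇ r ≡ true ⊎ toℕ r < t)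
        h' (inj₁ e) = inj₁ e
        h' (inj₂ l) with split< le r l
        ... | inj₁ e = ⊥-elim (ne e)
        ... | inj₂ l' = inj₂ l'

    zeroOutUpTo : ∀ t → t ≤ m → ZeroingState t
    zeroOutUpTo zero _ with exchangeUpTo m NatP.≤-refl
    ... | X , RX , SX , IX = X , RX , SX , λ { r (inj₁ e) → IX r (nonzero⇒fixed r e) ; r (inj₂ ()) }
    zeroOutUpTo (suc t) le with zeroOutUpTo t (NatP.<⇒≤ le)
    ... | X , RX , SX , IX with nonzeroᵇ (rowAt le) in nzr
    ... | true = X , RX , SX , inv
      where
      inv : ∀ r → (nonzeroᵇ r ≡ true ⊎ toℕ r < suc t) → lookup X r ≡ lookup Y r
      inv r (inj₁ e) = IX r (inj₁ e)
      inv r (inj₂ l) with split< le r l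
      ... | inj₁ refl = IX r (inj₁ nzr)
      ... | inj₂ l' = IX r (inj₂ l')
    ... | false = clearRow le (X , RX , SX , IX) nzr

    related : R X0 Y
    related with zeroOutUpTo m NatP.≤-refl
    ... | X , RX , SX , IX = subst (R X0) (lookup-ext λ r → IX r (inj₂ (FinP.toℕ<n r))) RX

  sameCode⇒related : ∀ X Y → SameCode X Y → R X Y
  sameCode⇒related X Y S with normalise m NatP.≤-refl Y
  ... | Y' , RY , SY , NY = Rtrans (Exchange.related Y' (λ r → NY r (FinP.toℕ<n r)) X (λ x → trans (S x) (sym (SY x)))) (Rsym RY)

-- rowOp X i c maps every column v to A v + b with A = 1 + e_i (c₁ … c_m) and
-- b = c₀ e_i; since c_i = 0, A is an involution, so this is the action of an
-- element of AGL(m,2).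
module RowOpAffine {m N : ℕ} (X : Matrix m N) (i : Fin m) (c : Fin (suc m) → Bool) (ci : c (suc i) ≡ false) where
  A : Fin m → Fin m → Bool
  A t s = δ t s xor (δ t i ∧ c (suc s))
  b : Vec Bool m
  b = tabulate (λ t → δ t i ∧ c zero)
  g : Vec Bool m → Vec Bool m
  g = affine A b

  S : Vec Bool m → Bool
  S v = parity m (λ s → c (suc s) ∧ lookup v s)

  lookup-A : ∀ v t → lookup (applyM A v) t ≡ lookup v t xor (δ t i ∧ S v)
  lookup-A v t = begin
    lookup (applyM A v) t ≡⟨ lookup-applyM A v t ⟩
    parity m (λ s → (δ t s xor (δ t i ∧ c (suc s))) ∧ lookup v s)
      ≡⟨ parity-cong m (λ s → BoolP.∧-distribʳ-xor (lookup v s) (δ t s) _) ⟩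
    parity m (λ s → (δ t s ∧ lookup v s) xor ((δ t i ∧ c (suc s)) ∧ lookup v s)) ≡⟨ parity-xor m _ _ ⟩
    parity m (λ s → δ t s ∧ lookup v s) xor parity m (λ s → (δ t i ∧ c (suc s)) ∧ lookup v s)
      ≡⟨ cong₂ _xor_ (trans (parity-cong m (λ s → cong (_∧ lookup v s) (δ-sym t s))) (parity-δ m t (lookup v)))
                     (trans (parity-cong m (λ s → BoolP.∧-assoc (δ t i) _ _)) (parity-∧ˡ m (δ t i) _)) ⟩
    lookup v t xor (δ t i ∧ S v) ∎

  SA : ∀ v → S (applyM A v) ≡ S v
  SA v = begin
    parity m (λ s → c (suc s) ∧ lookup (applyM A v) s) ≡⟨ parity-cong m (λ s → cong (c (suc s) ∧_) (lookup-A v s)) ⟩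
    parity m (λ s → c (suc s) ∧ (lookup v s xor (δ s i ∧ S v))) ≡⟨ parity-cong m (λ s → BoolP.∧-distribˡ-xor (c (suc s)) _ _) ⟩
    parity m (λ s → (c (suc s) ∧ lookup v s) xor (c (suc s) ∧ (δ s i ∧ S v))) ≡⟨ parity-xor m _ _ ⟩
    S v xor parity m (λ s → c (suc s) ∧ (δ s i ∧ S v))
      ≡⟨ cong (S v xor_) (trans (parity-cong m (λ s → ∧-swapˡ (c (suc s)) (δ s i) (S v))) (parity-δ m i (λ s → c (suc s) ∧ S v))) ⟩
    S v xor (c (suc i) ∧ S v) ≡⟨ cong (λ z → S v xor (z ∧ S v)) ci ⟩
    S v xor false ≡⟨ BoolP.xor-identityʳ _ ⟩
    S v ∎

  A-involutive : ∀ v → applyM A (applyM A v) ≡ v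
  A-involutive v = lookup-ext λ t → begin
    lookup (applyM A (applyM A v)) t ≡⟨ lookup-A (applyM A v) t ⟩
    lookup (applyM A v) t xor (δ t i ∧ S (applyM A v)) ≡⟨ cong₂ (λ u w → u xor (δ t i ∧ w)) (lookup-A v t) (SA v) ⟩
    (lookup v t xor (δ t i ∧ S v)) xor (δ t i ∧ S v) ≡⟨ BoolP.xor-assoc (lookup v t) _ _ ⟩
    lookup v t xor ((δ t i ∧ S v) xor (δ t i ∧ S v)) ≡⟨ cong (lookup v t xor_) (BoolP.xor-same (δ t i ∧ S v)) ⟩
    lookup v t xor false ≡⟨ BoolP.xor-identityʳ _ ⟩
    lookup v t ∎

  Sb : S b ≡ false
  Sb = begin
    parity m (λ s → c (suc s) ∧ lookup b s) ≡⟨ parity-cong m (λ s → cong (c (suc s) ∧_) (lookup∘tabulate (λ t → δ t i ∧ c zero) s)) ⟩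
    parity m (λ s → c (suc s) ∧ (δ s i ∧ c zero)) ≡⟨ trans (parity-cong m (λ s → ∧-swapˡ (c (suc s)) (δ s i) (c zero))) (parity-δ m i (λ s → c (suc s) ∧ c zero)) ⟩
    c (suc i) ∧ c zero ≡⟨ cong (_∧ c zero) ci ⟩
    false ∎

  Ab : applyM A b ≡ b
  Ab = lookup-ext λ t → trans (lookup-A b t) (trans (cong (λ z → lookup b t xor (δ t i ∧ z)) Sb)
         (trans (cong (lookup b t xor_) (BoolP.∧-zeroʳ (δ t i))) (BoolP.xor-identityʳ _)))

  g-involutive : ∀ v → g (g v) ≡ v
  g-involutive v = begin
    addV (applyM A (addV (applyM A v) b)) b ≡⟨ cong (λ z → addV z b) (applyM-addV A (applyM A v) b) ⟩
    addV (addV (applyM A (applyM A v)) (applyM A b)) b ≡⟨ cong₂ (λ u w → addV (addV u w) b) (A-involutive v) Ab ⟩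
    addV (addV v b) b ≡⟨ addV-cancelʳ v b ⟩
    v ∎

  colMap-g≡rowOp : colMap g X ≡ rowOp X i c
  colMap-g≡rowOp = lookup-ext λ t → lookup-ext λ j → trans (lhs t j) (sym (rhs t j))
    where
    lhs : ∀ t j → lookup (lookup (colMap g X) t) j ≡ lookup (lookup X t) j xor ((δ t i ∧ S (col X j)) xor (δ t i ∧ c zero))
    lhs t j = begin
      lookup (lookup (colMap g X) t) j ≡⟨ cong (λ r → lookup r j) (lookup∘tabulate (λ t → tabulate (λ j → lookup (g (col X j)) t)) t) ⟩
      lookup (tabulate (λ j → lookup (g (col X j)) t)) j ≡⟨ lookup∘tabulate (λ j → lookup (g (col X j)) t) j ⟩
      lookup (addV (applyM A (col X j)) b) t ≡⟨ lookup-addV (applyM A (col X j)) b t ⟩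
      lookup (applyM A (col X j)) t xor lookup b t ≡⟨ cong₂ _xor_ (lookup-A (col X j) t) (lookup∘tabulate (λ t → δ t i ∧ c zero) t) ⟩
      (lookup (col X j) t xor (δ t i ∧ S (col X j))) xor (δ t i ∧ c zero) ≡⟨ BoolP.xor-assoc (lookup (col X j) t) (δ t i ∧ S (col X j)) (δ t i ∧ c zero) ⟩
      lookup (col X j) t xor ((δ t i ∧ S (col X j)) xor (δ t i ∧ c zero)) ≡⟨ cong (_xor ((δ t i ∧ S (col X j)) xor (δ t i ∧ c zero))) (lookup-col X j t) ⟩
      lookup (lookup X t) j xor ((δ t i ∧ S (col X j)) xor (δ t i ∧ c zero)) ∎
    rhs : ∀ t j → lookup (lookup (rowOp X i c) t) j ≡ lookup (lookup X t) j xor ((δ t i ∧ S (col X j)) xor (δ t i ∧ c zero))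
    rhs t j with t F.≟ i
    ... | yes refl = begin
      lookup (lookup (rowOp X t c) t) j ≡⟨ cong (λ r → lookup r j) (lookup-updateRow-same X t _) ⟩
      lookup (addV (lookup X t) (linComb (generators X) c)) j ≡⟨ lookup-addV (lookup X t) _ j ⟩
      lookup (lookup X t) j xor lookup (linComb (generators X) c) j ≡⟨ cong (lookup (lookup X t) j xor_) (lookup-linComb (generators X) c j) ⟩
      lookup (lookup X t) j xor ((c zero ∧ lookup onesV j) xor parity m (λ s → c (suc s) ∧ lookup (lookup X s) j))
        ≡⟨ cong (lookup (lookup X t) j xor_) (trans (cong₂ _xor_ (trans (cong (c zero ∧_) (lookup-onesV j)) (BoolP.∧-identityʳ _))
             (parity-cong m (λ s → cong (c (suc s) ∧_) (sym (lookup-col X j s))))) (BoolP.xor-comm (c zero) _)) ⟩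
      lookup (lookup X t) j xor (S (col X j) xor c zero)
        ≡⟨ cong (λ z → lookup (lookup X t) j xor ((z ∧ S (col X j)) xor (z ∧ c zero))) (sym (δ-refl t)) ⟩
      lookup (lookup X t) j xor ((δ t t ∧ S (col X j)) xor (δ t t ∧ c zero)) ∎
    ... | no ne = trans (cong (λ r → lookup r j) (lookup-updateRow-other X i _ t ne))
      (sym (trans (cong (λ z → lookup (lookup X t) j xor ((z ∧ S (col X j)) xor (z ∧ c zero))) (≢⇒δ-false t i ne))
        (BoolP.xor-identityʳ _)))

  eqVg : ∀ u w → eqV (g u) w ≡ eqV u (g w)
  eqVg u w = bool-ext (λ e → eqV-complete (trans (sym (g-involutive u)) (cong g (eqV-sound e))))
                    (λ e → eqV-complete (trans (cong g (eqV-sound e)) (g-involutive w)))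

  exponent-rowOp : ∀ w → exponent (rowOp X i c) w ≡ exponent X (g w)
  exponent-rowOp w = trans (cong (λ Z → exponent Z w) (sym colMap-g≡rowOp))
    (countB-cong (allFinL N) (λ j → trans (cong (λ z → eqV z w) (col-colMap g X j)) (eqVg (col X j) w)))

-- The basis

countB-pos : ∀ {A : Set} (p : A → Bool) (L : List A) {a} → a ∈ L → p a ≡ true → ∃ λ n → countB p L ≡ suc n
countB-pos p (b ∷ L) (here refl) e rewrite e = countB p L , refl
countB-pos p (b ∷ L) (there q) e with p b
... | true = countB p L , refl
... | false = countB-pos p L q e

module Basis {c ℓ : Level} (K : CharZeroField c ℓ) (m N : ℕ) where
  open CharZeroField K hiding (refl; sym; trans; _+_)
  open CharZeroField K using () renaming (refl to ≈-refl; sym to ≈-sym; trans to ≈-trans; _+_ to _+ᴷ_)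
  open Poly K m
  open Invariance K m
  open CharZeroFieldProperties K

  lincombP-zero : ∀ {k} (λs : Fin k → Carrier) (b : Fin k → Pol) e → (∀ j → b j e ≈ 0#) → lincombP λs b e ≈ 0#
  lincombP-zero {k} λs b e h = go (allFinL k)
    where
    go : ∀ L → foldr (λ j s → λs j * b j e +ᴷ s) 0# L ≈ 0#
    go [] = ≈-refl
    go (j ∷ L) = ≈-trans (+-cong (≈-trans (*-congˡ (h j)) (zeroʳ (λs j))) (go L)) (+-identityˡ 0#)

  lincombP-single : ∀ {k} (λs : Fin k → Carrier) (b : Fin k → Pol) e i → (∀ j → j ≢ i → b j e ≈ 0#)
    → lincombP λs b e ≈ λs i * b i e
  lincombP-single {k} λs b e i h with ∈-∃++ (proj₂ (allFin-enumeration k) i)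
  ... | as , bs , eq = ≈-trans (reflexive (trans (cong (foldr step 0#) eq) (ListP.foldr-++ step 0# as (i ∷ bs))))
        (≈-trans (zeros as (λ q → ∈-++⁺ˡ q)) (≈-trans (+-congˡ (zeros bs (λ q → ∈-++⁺ʳ as q))) (+-identityʳ _)))
    where
    step : Fin k → Carrier → Carrier
    step j s = λs j * b j e +ᴷ s
    i∉ : i ∉ as ++ bs
    i∉ = proj₂ (Unique-dropMiddle as (subst Unique eq (proj₁ (allFin-enumeration k))))
    zeros : ∀ L {z} → (∀ {j} → j ∈ L → j ∈ as ++ bs) → foldr step z L ≈ z
    zeros [] inc = ≈-refl
    zeros (j ∷ L) inc = ≈-trans (+-cong (≈-trans (*-congˡ (h j (λ { refl → i∉ (inc (here refl)) }))) (zeroʳ (λs j)))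
      (zeros L (λ q → inc (there q)))) (+-identityˡ _)

  invariant-respects-span : ∀ p → Extensional p → Invariant p → ∀ (X Y : Matrix m N) → (∀ x → codeOf X x ≡ codeOf Y x)
    → p (exponent X) ≈ p (exponent Y)
  invariant-respects-span p pext pinv = RowReduction.sameCode⇒related R ≈-refl ≈-sym ≈-trans op
    where
    R : Matrix m N → Matrix m N → Set ℓ
    R X Y = p (exponent X) ≈ p (exponent Y)
    op : ∀ X i c → c (suc i) ≡ false → R X (rowOp X i c)
    op X i c ci = ≈-trans (≈-sym (pinv (affP A b (A , A-involutive , A-involutive)) (exponent X))) (pext _ _ (λ w → sym (exponent-rowOp w)))
      where open RowOpAffine X i c ci

  invariant-vanishes : ∀ p → Invariant p → (M : Matrix m N) → ∀ e → (∀ v → e v ≡ exponent M v)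
    → ∀ i i' → dot (generators M i) (generators M i') ≡ true → p e ≈ 0#
  invariant-vanishes p pinv M e hM i i' nonOrth with nonOrthogonal⇒oddParity M i i' nonOrth
  ... | q , a , odd = -x≈x⇒x≈0 (flipped (signBit e q a) (trans (signBit-exponent M e hM q a) odd) (pinv (diagP q a) e))
    where
    flipped : ∀ s → s ≡ true → (if s then - p e else p e) ≈ p e → - p e ≈ p e
    flipped true _ h = h

  μ-vanishes : ∀ (C C' : Code N) (M : Matrix m N) → spans M C' ≡ true → ¬ Equivalent C C'
    → ∀ e → (∀ v → e v ≡ exponent M v) → μ C e ≈ 0#
  μ-vanishes C C' M s ¬eqv e he = reflexive (cong (ringℕ cring) (countB-zero _ (matrices N) (λ {M'} _ → noContribution M')))
    where
    noContribution : ∀ M' → spans M' C ∧ hasExponent M' e ≡ false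
    noContribution M' with spans M' C in s' | hasExponent M' e in t
    ... | false | _ = refl
    ... | true | false = refl
    ... | true | true = ⊥-elim (¬eqv (sameExponent⇒Equivalent M' M C C' s' s (λ v → trans (sym (hasExponent-sound M' e t v)) (he v))))

  μ-nonzero : ∀ (C : Code N) (M : Matrix m N) → spans M C ≡ true → ¬ (μ C (exponent M) ≈ 0#)
  μ-nonzero C M s μ≈0 with countB-pos _ (matrices N) (proj₂ (matrices-enumeration N m) M) (true-∧ s (hasExponent-complete M (exponent M) (λ _ → refl)))
  ... | n , cnt = charZero n (subst (_≈ 0#) (cong (ringℕ cring) cnt) μ≈0)

  module _ {k : ℕ} (reps : Fin k → Code N)
    (adm : ∀ i → Admissible m (reps i))
    (uniq : ∀ i j → Equivalent (reps i) (reps j) → i ≡ j)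
    (compl : ∀ (C : Code N) → Admissible m C → ∃ λ i → Equivalent C (reps i)) where

    b : Fin k → Pol
    b i = μ (reps i)

    b-inSpace : ∀ i → InSpace N (b i)
    b-inSpace i with adm i
    ... | _ , so , _ = μ-inSpace (reps i) so

    repMatrix : ∀ i → Σ (Matrix m N) λ M → spans M (reps i) ≡ true
    repMatrix i with adm i
    ... | _ , _ , one , (d , d≤ , dim) = spanningMatrix (reps i) one d d≤ dim

    witness : Fin k → Exp m
    witness i = exponent (proj₁ (repMatrix i))

    b-witness≉0 : ∀ i → ¬ (b i (witness i) ≈ 0#)
    b-witness≉0 i = μ-nonzero (reps i) (proj₁ (repMatrix i)) (proj₂ (repMatrix i))

    b-vanishes : ∀ i j (M : Matrix m N) → spans M (reps i) ≡ true → j ≢ i → ∀ e → (∀ v → e v ≡ exponent M v) → b j e ≈ 0#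
    b-vanishes i j M s j≢i = μ-vanishes (reps j) (reps i) M s (λ eqv → j≢i (uniq j i eqv))

    independent : ∀ (λs : Fin k → Carrier) → (∀ e → lincombP λs b e ≈ 0#) → ∀ i → λs i ≈ 0#
    independent λs H i = x*r≈0⇒x≈0 (b-witness≉0 i)
      (≈-trans (≈-sym (lincombP-single λs b (witness i) i
        (λ j j≢i → b-vanishes i j (proj₁ (repMatrix i)) (proj₂ (repMatrix i)) j≢i (witness i) (λ _ → refl))))
        (H (witness i)))

    spanning : ∀ p → InSpace N p → ∃ λ (λs : Fin k → Carrier) → ∀ e → p e ≈ lincombP λs b e
    spanning p ((pext , phom) , pinv) = λs , coeff
      where
      λs : Fin k → Carrier
      λs i = p (witness i) * proj₁ (inverse (b i (witness i)) (b-witness≉0 i))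
      coeff : ∀ e → p e ≈ lincombP λs b e
      coeff e with deg e NatP.≟ N
      ... | no ne = ≈-trans (phom e ne) (≈-sym (lincombP-zero λs b e (λ j → proj₂ (μ-homogeneous (reps j)) e ne)))
      ... | yes d with exponent⇒matrix e d
      ... | M , hM with orthogonal? M
      ... | inj₂ (i , i' , nonOrth) = ≈-trans (invariant-vanishes p pinv M e hM i i' nonOrth)
            (≈-sym (lincombP-zero λs b e (λ j → invariant-vanishes (b j) (proj₂ (b-inSpace j)) M e hM i i' nonOrth)))
      ... | inj₁ orth with compl (codeOf M) (codeOf-admissible M orth)
      ... | i , eqv with Equivalent⇒spanningMatrix M (reps i) eqv
      ... | M' , s' , hM' = ≈-sym (≈-trans (lincombP-single λs b e i (λ j j≢i → b-vanishes i j M' s' j≢i e he'))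
            (≈-trans (*-congˡ bi) (≈-trans (*-inverse-cancelʳ (p (witness i)) (proj₂ (inverse _ (b-witness≉0 i)))) (≈-sym pi))))
        where
        he' : ∀ v → e v ≡ exponent M' v
        he' v = trans (hM v) (sym (hM' v))
        Mi = proj₁ (repMatrix i)
        sp : ∀ x → codeOf M' x ≡ codeOf Mi x
        sp x = trans (sym (spans-sound M' (reps i) s' x)) (spans-sound Mi (reps i) (proj₂ (repMatrix i)) x)
        pi : p e ≈ p (witness i)
        pi = ≈-trans (pext e (exponent M') he') (invariant-respects-span p pext pinv M' Mi sp)
        bi : b i e ≈ b i (witness i)
        bi = ≈-trans (μ-ext (reps i) e (exponent M') he') (invariant-respects-span (b i) (μ-ext (reps i)) (proj₂ (b-inSpace i)) M' Mi sp)

lemma4p4 : {c ℓ : Level} (K : CharZeroField c ℓ) (m : ℕ) → 1 ≤ m → (N k : ℕ)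
    → (reps : Fin k → Code N)
    → (∀ i → Admissible m (reps i))
    → (∀ i j → Equivalent (reps i) (reps j) → i ≡ j)
    → (∀ (C : Code N) → Admissible m C → ∃ λ i → Equivalent C (reps i))
    → Poly.IsBasisOfInvariants K m N (λ i → Poly.μ K m (reps i))
lemma4p4 K m _ N k reps adm uniq compl =
  b-inSpace reps adm uniq compl , independent reps adm uniq compl , spanning reps adm uniq compl
  where open Basis K m N
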